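{- Let $n\ge3$ and $2\le k\le n$ be integers, and let $\mathbf{a}\in[n]^n$ be the input of the DFS-Burning Algorithm applied to $\overline{\mathcal{G}^k_n}$; let $\langle 0=i_0,i_1,\dotsc,i_m\rangle$ be the list of burnt vertices at the end of the execution. Then the following are equivalent: (1) $\mathbf{a}$ parks every element of $[k,n]$ and $i_p=1$ for some $1\le p\le m$; (2) $\mathbf{a}$ is a $k$-partial parking function; (3) as a set, $\{i_0,\dotsc,i_m\}=\{0\}\cup[n]$, equivalently $m=n$.
   Context: $[m,n]=\{i\in\mathbb{Z}\mid m\le i\le n\}$, $[n]=[1,n]$. $\overline{\mathcal{G}^k_n}$ is the directed multigraph on $\{0\}\cup[n]$ whose out-neighbour lists $\mathcal{N}(v)$ are ordered as follows (an entry $i+mn$ with $i\in[n]$, $m\ge0$ denotes a distinct copy of an arc to vertex $i$): $\mathcal{N}(0)=\langle n,n-1,\dotsc,1\rangle$; $\mathcal{N}(1)$ consists of the entries $i+mn$ for every $i\in[2,n]$ and every $0\le m\le \min\{i,k\}-2$, sorted by $i$ in descending order, ties broken by $m$ in descending order; for $i\in[2,n]$, $\mathcal{N}(i)$ consists of every $m$ with $1\le m<i$ and, exactly when $i\ge k$, also every $m$ with $i<m\le n$, sorted in descending order. (This is the graph with an arc $(0,v)$ for each $v\in[n]$ and the reverse of each arc of the multigraph $\mathcal{G}^k_n$ associated with the arrangement $\mathcal{A}^k_n$ consisting of hyperplanes $x_i=x_j$ ($i<j$), $x_1=x_j+i$ ($i<j$, $i<k$), $x_i=x_j+1$ ($k\le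 i<j$), where $x_i=x_j$ gives arc $(i,j)$ and $x_i=x_j+a$, $a\in\mathbb{N}$, gives arc $(j,i)$.) DFS-Burning Algorithm with input $\mathbf{a}$: the burnt list starts as $\langle0\rangle$; run DFS_FROM$(0)$, where DFS_FROM$(i)$ goes through the entries of $\mathcal{N}(i)$ in order and for each entry, referring to vertex $v$: if $v$ is not yet burnt, then if $a_v=1$ append $v$ to the burnt list and run DFS_FROM$(v)$, otherwise replace $a_v$ by $a_v-1$. Parking Algorithm with input $\mathbf{a}\in[n]^n$: start with $\mathrm{spp}=(0,\dotsc,0)\in\mathbb{Z}^{2n}$; for each $i\in[n]$ in descending order set $p=a_i$, increase $p$ by one while $\mathrm{spp}(p)\ne0$, then $\mathrm{pp}(i)=p$, $\mathrm{spp}(p)=i$; $\mathbf{a}$ parks $i$ if $\mathrm{pp}(i)\le n$. Centre: $Z(\mathbf{b})$ is the largest set $\{i_1,\dotsc,i_m\}\subseteq[n]$ with $i_1>\dotsb>i_m$ and $b_{i_j}\le j$ for all $j$. With $\pi\in\mathfrak{S}_n$ such that $\pi(i)=i$ for $i<k$ and $a_{\pi(i)}\ge a_{\pi(i+1)}$ for $k\le i<n$, set $\mathbf{a}^{(k)}=\mathbf{a}\circ\pi$. $\mathbf{a}$ is a $k$-partial parking function if it parks every element of $[k,n]$ and $1\in Z(\mathbf{a}^{(k)})$. -}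

module Defs where

open import Data.Bool using (Bool; true; false; if_then_else_)
open import Data.Nat using (ℕ; zero; suc; _+_; _*_; _∸_; _≤_; _<_; _>_; _≟_; _≤?_; _⊓_)
open import Data.Nat.Properties using (≤-decTotalOrder)
open import Data.List using (List; []; _∷_; _++_; [_]; map; concatMap; filter; downFrom; reverse; foldl; take; drop; length)
open import Data.List.Membership.DecPropositional _≟_ using (_∈?_)
open import Data.List.Membership.Propositional using (_∈_)
open import Data.List.Relation.Unary.Linked using (Linked)
open import Data.List.Sort.InsertionSort ≤-decTotalOrder using (sort)
open import Data.Vec using (Vec; toList)
open import Data.Product using (_×_; _,_; proj₁; proj₂; Σ; ∃)
open import Data.Unit using (⊤)
open import Relation.Nullary.Decidable using (does)

desc : ℕ → ℕ → List ℕ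
desc lo hi = filter (lo ≤?_) (downFrom (suc hi))

-- 1-indexed lookup in a list: xs ! i = x_i  (0 if out of range; never
-- used out of range)
_!_ : List ℕ → ℕ → ℕ
[]       ! _           = 0
(x ∷ xs) ! zero        = 0
(x ∷ xs) ! suc zero    = x
(x ∷ xs) ! suc (suc i) = xs ! suc i

at : ∀ {n} → Vec ℕ n → ℕ → ℕ
at a i = toList a ! i

-- The multigraph Ḡ^k_n via ordered out-neighbour lists.
-- An entry is a pair (v , m): the m-th copy of an arc to vertex v
-- (the paper writes it as the number v + m n).

Entry : Set
Entry = ℕ × ℕ

copy0 : ℕ → Entry
copy0 v = v , 0

nbrs : (n k v : ℕ) → List Entry
nbrs n k zero = map copy0 (desc 1 n)
nbrs n k (suc zero) =
  concatMap (λ i → map (λ m → i , m) (downFrom (suc ((i ⊓ k) ∸ 2)))) (desc 2 n)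
nbrs n k (suc (suc j)) with does (suc (suc j) ≤? n)
... | false = []
... | true  = map copy0
  ((if does (k ≤? suc (suc j)) then desc (suc (suc (suc j))) n else [])
   ++ desc 1 (suc j))

record State : Set where
  constructor st
  field
    counter : ℕ → ℕ
    burnt   : List ℕ

isBurnt : ℕ → State → Bool
isBurnt v s = does (v ∈? State.burnt s)

update : (ℕ → ℕ) → ℕ → ℕ → (ℕ → ℕ)
update f v x w = if does (w ≟ v) then x else f w

-- The recursion depth of DFS_FROM is bounded by the number of burnt
-- vertices (≤ n+1), so fuel n+2 never runs out.
mutual
  dfsFrom : (n k fuel i : ℕ) → State → State
  dfsFrom n k zero    i s = s
  dfsFrom n k (suc f) i s = goList n k f (nbrs n k i) s

  goList : (n k fuel : ℕ) → List Entry → State → State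
  goList n k f []             s = s
  goList n k f ((v , _) ∷ es) s = goList n k f es (visit n k f v s)

  visit : (n k fuel v : ℕ) → State → State
  visit n k f v s with isBurnt v s
  ... | true  = s
  ... | false with does (State.counter s v ≟ 1)
  ...   | true  = dfsFrom n k f v (st (State.counter s) (State.burnt s ++ [ v ]))
  ...   | false = st (update (State.counter s) v (State.counter s v ∸ 1)) (State.burnt s)

burntList : (n k : ℕ) → Vec ℕ n → List ℕ
burntList n k a = State.burnt (dfsFrom n k (suc (suc n)) 0 (st (at a) [ 0 ]))

-- increase p while position p is occupied (fuel n suffices: fewer than
-- n positions are occupied at any time)
findFree : ℕ → List ℕ → ℕ → ℕ
findFree zero    occ p = p
findFree (suc f) occ p = if does (p ∈? occ) then findFree f occ (suc p) else p

parkTable : (n : ℕ) → Vec ℕ n → List (ℕ × ℕ)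
parkTable n a = foldl step [] (desc 1 n)
  where
  step : List (ℕ × ℕ) → ℕ → List (ℕ × ℕ)
  step t i = (i , findFree (suc n) (map proj₂ t) (at a i)) ∷ t

lookupPP : List (ℕ × ℕ) → ℕ → ℕ
lookupPP []            i = 0
lookupPP ((j , p) ∷ t) i = if does (i ≟ j) then p else lookupPP t i

pp : (n : ℕ) → Vec ℕ n → ℕ → ℕ
pp n a i = lookupPP (parkTable n a) i

Parks : (n : ℕ) → Vec ℕ n → ℕ → Set
Parks n a i = pp n a i ≤ n

ParksFrom : (n k : ℕ) → Vec ℕ n → Set
ParksFrom n k a = ∀ i → k ≤ i → i ≤ n → Parks n a i

IndexBound : (ℕ → ℕ) → ℕ → List ℕ → Set
IndexBound b j []       = ⊤
IndexBound b j (x ∷ xs) = (b x ≤ j) × IndexBound b (suc j) xs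

InRange : ℕ → ℕ → Set
InRange n x = (1 ≤ x) × (x ≤ n)

Admissible : (n : ℕ) → (ℕ → ℕ) → List ℕ → Set
Admissible n b S = Linked _>_ S × (∀ x → x ∈ S → InRange n x) × IndexBound b 1 S

IsCentre : (n : ℕ) → (ℕ → ℕ) → List ℕ → Set
IsCentre n b S = Admissible n b S × (∀ T → Admissible n b T → ∀ x → x ∈ T → x ∈ S)

InCentre : (n : ℕ) → (ℕ → ℕ) → ℕ → Set
InCentre n b x = Σ (List ℕ) λ S → IsCentre n b S × x ∈ S

sortDesc : List ℕ → List ℕ
sortDesc xs = reverse (sort xs)

aK : (n k : ℕ) → Vec ℕ n → ℕ → ℕ
aK n k a = (take (k ∸ 1) (toList a) ++ sortDesc (drop (k ∸ 1) (toList a))) !_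

KPartialPF : (n k : ℕ) → Vec ℕ n → Set
KPartialPF n k a = ParksFrom n k a × InCentre n (aK n k a) 1

-- The burnt set of the DFS-Burning Algorithm is the least set C ∋ 0 that is stable: every
-- v ∈ [n] outside C receives fewer than a_v arcs from C. Indeed the counters never let a vertex
-- outside a stable set burn, and when the algorithm stops the burnt set is stable. In Ḡ^k_n a
-- set C ∋ 0 sends (if 1 ∈ C then min(v, k) else 1) + |C ∩ (v, n]| arcs to 2 ≤ v < k, and the
-- same with (v, n] replaced by [k, n] to v ≥ k outside C, so stability is a counting condition.
-- For the cars in [k, n] it is Hall's condition for parking: they all park iff no set of them,
-- all preferring spots ≥ j, outnumbers the spots [j, n]. For 1 and 2, …, k − 1 it is the
-- condition defining the centre Z(a^(k)), which is computed greedily from n downwards; a^(k)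
-- only reorders the entries on [k, n], which these counts do not see.

module Submission where

open import Defs
open import Data.Bool using (Bool; true; false; _∨_; _∧_; not; if_then_else_; T)
open import Data.Bool.Properties using (T-≡; not-injective; ∨-identityʳ; ∨-assoc; ∨-zeroʳ; ∧-identityʳ; ∧-zeroʳ; ∧-conicalˡ; ∧-conicalʳ)
open import Data.Nat
open import Data.Nat.Properties
open import Data.List using (List; []; _∷_; _++_; [_]; map; filter; downFrom; concatMap; length; foldl; take; drop; reverse)
open import Data.List.Relation.Unary.All as Allₗ using ([]; _∷_)
open import Data.List.Relation.Unary.All.Properties using (all-filter; filter⁺; applyDownFrom⁺₁; map⁺; ++⁺; concat⁺)
open import Data.List.Membership.Propositional using (_∈_)
open import Data.List.Membership.DecPropositional _≟_ using (_∈?_)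
open import Data.List.Relation.Unary.Any using (here; there)
open import Data.Vec using (Vec; toList; _∷_)
open import Data.Vec.Relation.Unary.All using (All; _∷_)
open import Data.Vec.Properties using (length-toList)
open import Data.List.Properties using (length-downFrom; length-take; length-drop; take++drop≡id)
open import Data.List.Relation.Unary.Linked as Linked using (Linked; []; [-]; _∷_)
open import Data.List.Relation.Binary.Permutation.Propositional using (_↭_; ↭-trans)
open import Data.List.Relation.Binary.Permutation.Propositional.Properties using (↭-reverse; ↭-length)
import Data.List.Relation.Binary.Permutation.Propositional.Properties as ↭
open import Data.List.Sort.InsertionSort.Properties ≤-decTotalOrder using (sort-↭; sort-↗)
open import Data.List.Sort.InsertionSort ≤-decTotalOrder using (sort)
open import Data.Nat.ListAction using (sum)
open import Data.Nat.ListAction.Properties using (sum-↭)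
open import Data.Product using (_×_; _,_; proj₁; proj₂; Σ)
open import Data.Sum using (_⊎_; inj₁; inj₂)
open import Data.Empty using (⊥; ⊥-elim)
open import Data.Unit using (⊤; tt)
open import Function using (_∘_; flip)
open import Function.Bundles using (_⇔_; mk⇔; Equivalence)
open import Relation.Nullary using (¬_; Dec; yes; no)
open import Relation.Nullary.Decidable using (does)
open import Relation.Binary.Definitions using (tri<; tri≈; tri>)
open import Relation.Binary.PropositionalEquality hiding ([_])
open import Algebra.Properties.CommutativeSemigroup +-commutativeSemigroup using (interchange)

T⇒≡true : ∀ {b} → T b → b ≡ true
T⇒≡true = Equivalence.to T-≡

¬T⇒≡false : ∀ {b} → ¬ T b → b ≡ false
¬T⇒≡false {false} _ = refl
¬T⇒≡false {true} ¬t = ⊥-elim (¬t tt)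

≡true⇒T : ∀ {b} → b ≡ true → T b
≡true⇒T refl = tt

true≢false : true ≢ false
true≢false ()

≡ᵇ-refl : ∀ v → (v ≡ᵇ v) ≡ true
≡ᵇ-refl v = T⇒≡true (≡⇒≡ᵇ v v refl)

≢⇒≡ᵇ-false : ∀ {u v} → u ≢ v → (u ≡ᵇ v) ≡ false
≢⇒≡ᵇ-false {u} {v} u≢v = ¬T⇒≡false (u≢v ∘ ≡ᵇ⇒≡ u v)

≡ᵇ-true⇒≡ : ∀ {u v} → (u ≡ᵇ v) ≡ true → u ≡ v
≡ᵇ-true⇒≡ {u} {v} e = ≡ᵇ⇒≡ u v (≡true⇒T e)

≤⇒≤ᵇ-true : ∀ {m n} → m ≤ n → (m ≤ᵇ n) ≡ true
≤⇒≤ᵇ-true = T⇒≡true ∘ ≤⇒≤ᵇ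

≤ᵇ-true⇒≤ : ∀ {m n} → (m ≤ᵇ n) ≡ true → m ≤ n
≤ᵇ-true⇒≤ {m} {n} e = ≤ᵇ⇒≤ m n (≡true⇒T e)

>⇒≤ᵇ-false : ∀ {m n} → n < m → (m ≤ᵇ n) ≡ false
>⇒≤ᵇ-false n<m = ¬T⇒≡false (<⇒≱ n<m ∘ ≤ᵇ⇒≤ _ _)

≤ᵇ-false⇒> : ∀ {m n} → (m ≤ᵇ n) ≡ false → n < m
≤ᵇ-false⇒> e = ≰⇒> (λ m≤n → true≢false (trans (sym (≤⇒≤ᵇ-true m≤n)) e))

<⇒<ᵇ-true : ∀ {m n} → m < n → (m <ᵇ n) ≡ true
<⇒<ᵇ-true = T⇒≡true ∘ <⇒<ᵇ

≮⇒<ᵇ-false : ∀ {m n} → ¬ m < n → (m <ᵇ n) ≡ false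
≮⇒<ᵇ-false m≮n = ¬T⇒≡false (m≮n ∘ <ᵇ⇒< _ _)

bit : Bool → ℕ
bit true = 1
bit false = 0

bit≤1 : ∀ b → bit b ≤ 1
bit≤1 true = s≤s z≤n
bit≤1 false = z≤n

bit-complement : ∀ b → bit b + bit (not b) ≡ 1
bit-complement true = refl
bit-complement false = refl

bit-mono : ∀ b c → (b ≡ true → c ≡ true) → bit b ≤ bit c
bit-mono false c _ = z≤n
bit-mono true c f rewrite f refl = ≤-refl

sumRange : (ℕ → ℕ) → ℕ → ℕ → ℕ
sumRange f lo zero = 0
sumRange f lo (suc l) = f lo + sumRange f (suc lo) l

countRange : (ℕ → Bool) → ℕ → ℕ → ℕ
countRange X = sumRange (bit ∘ X)

Within : ℕ → ℕ → ℕ → Set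
Within lo l u = lo ≤ u × u < lo + l

within-head : ∀ lo l → Within lo (suc l) lo
within-head lo l = ≤-refl , ≤-trans (s≤s (m≤m+n lo l)) (≤-reflexive (sym (+-suc lo l)))

within-tail : ∀ {lo l u} → Within (suc lo) l u → Within lo (suc l) u
within-tail {lo} {l} (p , q) = ≤-trans (n≤1+n lo) p , ≤-trans q (≤-reflexive (sym (+-suc lo l)))

within-next : ∀ {lo l u} → Within lo (suc l) u → lo ≢ u → Within (suc lo) l u
within-next {lo} {l} (p , q) lo≢u = ≤∧≢⇒< p lo≢u , ≤-trans q (≤-reflexive (+-suc lo l))

within-empty : ∀ {lo u} → ¬ Within lo 0 u
within-empty {lo} {u} (p , q) = <⇒≱ (subst (u <_) (+-identityʳ lo) q) p

sumRange-cong : ∀ f g lo l → (∀ u → Within lo l u → f u ≡ g u) → sumRange f lo l ≡ sumRange g lo l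
sumRange-cong f g lo zero h = refl
sumRange-cong f g lo (suc l) h =
  cong₂ _+_ (h lo (within-head lo l)) (sumRange-cong f g (suc lo) l (λ u r → h u (within-tail r)))

sumRange-mono : ∀ f g lo l → (∀ u → Within lo l u → f u ≤ g u) → sumRange f lo l ≤ sumRange g lo l
sumRange-mono f g lo zero h = z≤n
sumRange-mono f g lo (suc l) h =
  +-mono-≤ (h lo (within-head lo l)) (sumRange-mono f g (suc lo) l (λ u r → h u (within-tail r)))

sumRange-+ : ∀ f g lo l → sumRange (λ u → f u + g u) lo l ≡ sumRange f lo l + sumRange g lo l
sumRange-+ f g lo zero = refl
sumRange-+ f g lo (suc l) rewrite sumRange-+ f g (suc lo) l =
  interchange (f lo) (g lo) (sumRange f (suc lo) l) (sumRange g (suc lo) l)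

sumRange-const0 : ∀ lo l → sumRange (λ _ → 0) lo l ≡ 0
sumRange-const0 lo zero = refl
sumRange-const0 lo (suc l) = sumRange-const0 (suc lo) l

sumRange-zero : ∀ f lo l → (∀ u → Within lo l u → f u ≡ 0) → sumRange f lo l ≡ 0
sumRange-zero f lo l h = trans (sumRange-cong f (λ _ → 0) lo l h) (sumRange-const0 lo l)

sumRange-update : ∀ f g x c lo l → Within lo l x → (∀ u → u ≢ x → g u ≡ f u) → g x ≡ f x + c →
                  sumRange g lo l ≡ sumRange f lo l + c
sumRange-update f g x c lo zero r h e = ⊥-elim (within-empty r)
sumRange-update f g x c lo (suc l) r h e with lo ≟ x
... | yes refl = begin
  g lo + sumRange g (suc lo) l      ≡⟨ cong₂ _+_ e (sumRange-cong g f (suc lo) l (λ u r′ → h u (>⇒≢ (proj₁ r′)))) ⟩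
  f lo + c + sumRange f (suc lo) l  ≡⟨ +-assoc (f lo) c _ ⟩
  f lo + (c + sumRange f (suc lo) l) ≡⟨ cong (f lo +_) (+-comm c _) ⟩
  f lo + (sumRange f (suc lo) l + c) ≡⟨ +-assoc (f lo) _ c ⟨
  f lo + sumRange f (suc lo) l + c  ∎
  where open ≡-Reasoning
... | no lo≢x = begin
  g lo + sumRange g (suc lo) l        ≡⟨ cong₂ _+_ (h lo lo≢x) (sumRange-update f g x c (suc lo) l (within-next r lo≢x) h e) ⟩
  f lo + (sumRange f (suc lo) l + c)  ≡⟨ +-assoc (f lo) _ c ⟨
  f lo + sumRange f (suc lo) l + c    ∎
  where open ≡-Reasoning

sumRange-split : ∀ f lo l₁ l₂ → sumRange f lo (l₁ + l₂) ≡ sumRange f lo l₁ + sumRange f (lo + l₁) l₂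
sumRange-split f lo zero l₂ rewrite +-identityʳ lo = refl
sumRange-split f lo (suc l₁) l₂ rewrite sumRange-split f (suc lo) l₁ l₂ | +-suc lo l₁ = sym (+-assoc (f lo) _ _)

sumRange-swap : ∀ (h : ℕ → ℕ → ℕ) lo₁ l₁ lo₂ l₂ →
  sumRange (λ c → sumRange (h c) lo₂ l₂) lo₁ l₁ ≡ sumRange (λ s → sumRange (λ c → h c s) lo₁ l₁) lo₂ l₂
sumRange-swap h lo₁ zero lo₂ l₂ = sym (sumRange-const0 lo₂ l₂)
sumRange-swap h lo₁ (suc l₁) lo₂ l₂ rewrite sumRange-swap h (suc lo₁) l₁ lo₂ l₂ =
  sym (sumRange-+ (h lo₁) (λ s → sumRange (λ c → h c s) (suc lo₁) l₁) lo₂ l₂)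

sumRange-shift : ∀ f c lo l → sumRange f (c + lo) l ≡ sumRange (λ u → f (c + u)) lo l
sumRange-shift f c lo zero = refl
sumRange-shift f c lo (suc l) rewrite sym (+-suc c lo) = cong (f (c + lo) +_) (sumRange-shift f c (suc lo) l)

countRange-≤ : ∀ X lo l → countRange X lo l ≤ l
countRange-≤ X lo zero = z≤n
countRange-≤ X lo (suc l) = +-mono-≤ (bit≤1 (X lo)) (countRange-≤ X (suc lo) l)

countRange-all : ∀ X lo l → (∀ u → Within lo l u → X u ≡ true) → countRange X lo l ≡ l
countRange-all X lo zero h = refl
countRange-all X lo (suc l) h rewrite h lo (within-head lo l) =
  cong suc (countRange-all X (suc lo) l (λ u r → h u (within-tail r)))

countRange-true : ∀ lo l → countRange (λ _ → true) lo l ≡ l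
countRange-true lo l = countRange-all (λ _ → true) lo l (λ _ _ → refl)

countRange-pos : ∀ X lo l x → Within lo l x → X x ≡ true → 1 ≤ countRange X lo l
countRange-pos X lo zero x r e = ⊥-elim (within-empty r)
countRange-pos X lo (suc l) x r e with lo ≟ x
... | yes refl rewrite e = s≤s z≤n
... | no lo≢x = ≤-trans (countRange-pos X (suc lo) l x (within-next r lo≢x) e) (m≤n+m _ (bit (X lo)))

countRange-witness : ∀ X lo l → 1 ≤ countRange X lo l → Σ ℕ λ u → Within lo l u × X u ≡ true
countRange-witness X lo zero ()
countRange-witness X lo (suc l) p with X lo in eq
... | true = lo , within-head lo l , eq
... | false = let (u , r , e) = countRange-witness X (suc lo) l p in u , within-tail r , e

countRange-≤1 : ∀ X lo l → (∀ u w → Within lo l u → Within lo l w → X u ≡ true → X w ≡ true → u ≡ w) →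
                countRange X lo l ≤ 1
countRange-≤1 X lo zero h = z≤n
countRange-≤1 X lo (suc l) h with X lo in eq
... | false = countRange-≤1 X (suc lo) l (λ u w r s → h u w (within-tail r) (within-tail s))
... | true = ≤-reflexive (cong suc (sumRange-zero _ (suc lo) l λ u r → rest u r (X u) refl))
  where
  rest : ∀ u → Within (suc lo) l u → ∀ b → X u ≡ b → bit b ≡ 0
  rest u r false _ = refl
  rest u r true e = ⊥-elim (<-irrefl (h lo u (within-head lo l) (within-tail r) eq e) (proj₁ r))

countRange-complement : ∀ X lo l → countRange X lo l + countRange (not ∘ X) lo l ≡ l
countRange-complement X lo l = begin
  countRange X lo l + countRange (not ∘ X) lo l            ≡⟨ sumRange-+ (bit ∘ X) (bit ∘ not ∘ X) lo l ⟨
  sumRange (λ u → bit (X u) + bit (not (X u))) lo l        ≡⟨ sumRange-cong _ _ lo l (λ u _ → bit-complement (X u)) ⟩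
  countRange (λ _ → true) lo l                             ≡⟨ countRange-true lo l ⟩
  l                                                        ∎
  where open ≡-Reasoning

countRange-mono : ∀ X Y lo l → (∀ u → Within lo l u → X u ≡ true → Y u ≡ true) → countRange X lo l ≤ countRange Y lo l
countRange-mono X Y lo l h = sumRange-mono _ _ lo l (λ u r → bit-mono (X u) (Y u) (h u r))

sumRange-indicator-in : ∀ x lo l → Within lo l x → sumRange (λ s → bit (x ≡ᵇ s)) lo l ≡ 1
sumRange-indicator-in x lo l r =
  trans (sumRange-update (λ _ → 0) (λ s → bit (x ≡ᵇ s)) x 1 lo l r (λ u u≢x → cong bit (≢⇒≡ᵇ-false (u≢x ∘ sym))) (cong bit (≡ᵇ-refl x)))
        (cong (_+ 1) (sumRange-const0 lo l))

sumRange-indicator-out : ∀ x lo l → ¬ Within lo l x → sumRange (λ s → bit (x ≡ᵇ s)) lo l ≡ 0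
sumRange-indicator-out x lo l ∉ = sumRange-zero _ lo l (λ u r → cong bit (≢⇒≡ᵇ-false (λ x≡u → ∉ (subst (Within lo l) (sym x≡u) r))))

countRange-injection : ∀ X (f : ℕ → ℕ) lo l lo′ l′ →
  (∀ u → Within lo l u → X u ≡ true → Within lo′ l′ (f u)) →
  (∀ u w → Within lo l u → Within lo l w → X u ≡ true → X w ≡ true → f u ≡ f w → u ≡ w) →
  countRange X lo l ≤ l′
countRange-injection X f lo l lo′ l′ into inj = begin
  countRange X lo l                                 ≤⟨ sumRange-mono _ _ lo l hit ⟩
  sumRange (λ u → sumRange (h u) lo′ l′) lo l       ≡⟨ sumRange-swap h lo l lo′ l′ ⟩
  sumRange (λ s → sumRange (λ u → h u s) lo l) lo′ l′ ≤⟨ sumRange-mono _ (λ _ → 1) lo′ l′ (λ s _ → once s) ⟩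
  countRange (λ _ → true) lo′ l′                    ≡⟨ countRange-true lo′ l′ ⟩
  l′                                                ∎
  where
  open ≤-Reasoning
  h : ℕ → ℕ → ℕ
  h u s = bit (X u ∧ (f u ≡ᵇ s))
  hit : ∀ u → Within lo l u → bit (X u) ≤ sumRange (h u) lo′ l′
  hit u r with X u in Xu
  ... | false = z≤n
  ... | true = ≤-reflexive (sym (sumRange-indicator-in (f u) lo′ l′ (into u r Xu)))
  hits : ∀ u s → (X u ∧ (f u ≡ᵇ s)) ≡ true → X u ≡ true × f u ≡ s
  hits u s e = ∧-conicalˡ _ _ e , ≡ᵇ-true⇒≡ (∧-conicalʳ _ _ e)
  once : ∀ s → sumRange (λ u → h u s) lo l ≤ 1
  once s = countRange-≤1 (λ u → X u ∧ (f u ≡ᵇ s)) lo l λ u w ru rw eu ew →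
    let (Xu , fu) = hits u s eu ; (Xw , fw) = hits w s ew in inj u w ru rw Xu Xw (trans fu (sym fw))

countRange-surjection : ∀ X (f : ℕ → ℕ) lo l lo′ l′ →
  (∀ u → Within lo l u → Within lo′ l′ (f u) → X u ≡ true) →
  (∀ s → Within lo′ l′ s → Σ ℕ λ u → Within lo l u × f u ≡ s) →
  l′ ≤ countRange X lo l
countRange-surjection X f lo l lo′ l′ marked onto = begin
  l′                                                  ≡⟨ countRange-true lo′ l′ ⟨
  countRange (λ _ → true) lo′ l′                      ≤⟨ sumRange-mono (λ _ → 1) _ lo′ l′ hit ⟩
  sumRange (λ s → sumRange (λ u → h u s) lo l) lo′ l′ ≡⟨ sumRange-swap h lo l lo′ l′ ⟨
  sumRange (λ u → sumRange (h u) lo′ l′) lo l         ≤⟨ sumRange-mono _ _ lo l bound ⟩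
  countRange X lo l                                   ∎
  where
  open ≤-Reasoning
  h : ℕ → ℕ → ℕ
  h u s = bit (f u ≡ᵇ s)
  hit : ∀ s → Within lo′ l′ s → 1 ≤ sumRange (λ u → h u s) lo l
  hit s r = let (u , ru , fu) = onto s r in
    countRange-pos (λ u → f u ≡ᵇ s) lo l u ru (trans (cong (_≡ᵇ s) fu) (≡ᵇ-refl s))
  bound : ∀ u → Within lo l u → sumRange (h u) lo′ l′ ≤ bit (X u)
  bound u r with f u ≥? lo′ | f u <? lo′ + l′
  ... | yes p | yes q rewrite marked u r (p , q) = ≤-reflexive (sumRange-indicator-in (f u) lo′ l′ (p , q))
  ... | no ¬p | _ = ≤-trans (≤-reflexive (sumRange-indicator-out (f u) lo′ l′ (¬p ∘ proj₁))) z≤n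
  ... | _ | no ¬q = ≤-trans (≤-reflexive (sumRange-indicator-out (f u) lo′ l′ (¬q ∘ proj₂))) z≤n

module Tail (n : ℕ) where

  countFrom : (ℕ → Bool) → ℕ → ℕ
  countFrom X lo = countRange X lo (suc n ∸ lo)

  within⇒bounds : ∀ {lo u} → Within lo (suc n ∸ lo) u → lo ≤ u × u ≤ n
  within⇒bounds {lo} {u} (p , q) with lo ≤? suc n
  ... | yes lo≤1+n = p , ≤-pred (≤-trans q (≤-reflexive (m+[n∸m]≡n lo≤1+n)))
  ... | no lo≰1+n = ⊥-elim (<⇒≱ (≤-trans q (≤-reflexive (trans (cong (lo +_) (m≤n⇒m∸n≡0 (<⇒≤ (≰⇒> lo≰1+n)))) (+-identityʳ lo)))) p)

  bounds⇒within : ∀ {lo u} → lo ≤ u → u ≤ n → Within lo (suc n ∸ lo) u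
  bounds⇒within {lo} p q = p , ≤-trans (s≤s q) (≤-reflexive (sym (m+[n∸m]≡n (≤-trans p (≤-trans q (n≤1+n n))))))

  countFrom-step : ∀ X lo → lo ≤ n → countFrom X lo ≡ bit (X lo) + countFrom X (suc lo)
  countFrom-step X lo lo≤n rewrite +-∸-assoc 1 lo≤n = refl

  countFrom-beyond : ∀ X lo → n < lo → countFrom X lo ≡ 0
  countFrom-beyond X lo n<lo rewrite m≤n⇒m∸n≡0 n<lo = refl

  countFrom-≤ : ∀ X lo → countFrom X lo ≤ suc n ∸ lo
  countFrom-≤ X lo = countRange-≤ X lo _

  countFrom-suc-≤ : ∀ X lo → countFrom X (suc lo) ≤ countFrom X lo
  countFrom-suc-≤ X lo with lo ≤? n
  ... | yes lo≤n rewrite countFrom-step X lo lo≤n = m≤n+m _ _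
  ... | no lo≰n rewrite countFrom-beyond X (suc lo) (≤-trans (≰⇒> lo≰n) (n≤1+n lo)) = z≤n

  countFrom-antitone : ∀ X {lo lo′} → lo ≤ lo′ → countFrom X lo′ ≤ countFrom X lo
  countFrom-antitone X {lo} {zero} z≤n = ≤-refl
  countFrom-antitone X {lo} {suc lo′} p with m≤n⇒m<n∨m≡n p
  ... | inj₂ refl = ≤-refl
  ... | inj₁ (s≤s q) = ≤-trans (countFrom-suc-≤ X lo′) (countFrom-antitone X q)

  countFrom-cong : ∀ X Y lo → (∀ u → lo ≤ u → u ≤ n → X u ≡ Y u) → countFrom X lo ≡ countFrom Y lo
  countFrom-cong X Y lo h = sumRange-cong _ _ lo _ (λ u r → let (p , q) = within⇒bounds r in cong bit (h u p q))

  countFrom-mono : ∀ X Y lo → (∀ u → lo ≤ u → u ≤ n → X u ≡ true → Y u ≡ true) → countFrom X lo ≤ countFrom Y lo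
  countFrom-mono X Y lo h = countRange-mono X Y lo _ (λ u r → let (p , q) = within⇒bounds r in h u p q)

  countFrom-all : ∀ X lo → (∀ u → lo ≤ u → u ≤ n → X u ≡ true) → countFrom X lo ≡ suc n ∸ lo
  countFrom-all X lo h = countRange-all X lo _ (λ u r → let (p , q) = within⇒bounds r in h u p q)

  countFrom-complement : ∀ X lo → countFrom X lo + countFrom (not ∘ X) lo ≡ suc n ∸ lo
  countFrom-complement X lo = countRange-complement X lo (suc n ∸ lo)

  countFrom-witness : ∀ X lo → 1 ≤ countFrom X lo → Σ ℕ λ u → lo ≤ u × u ≤ n × X u ≡ true
  countFrom-witness X lo p = let (u , r , e) = countRange-witness X lo _ p ; (q , s) = within⇒bounds r in u , q , s , e

  countFrom-pos : ∀ X lo u → lo ≤ u → u ≤ n → X u ≡ true → 1 ≤ countFrom X lo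
  countFrom-pos X lo u p q e = countRange-pos X lo _ u (bounds⇒within p q) e

  countFrom-skip : ∀ X {lo} m → lo ≤ m → (∀ u → lo ≤ u → u < m → X u ≡ false) → countFrom X lo ≡ countFrom X m
  countFrom-skip X {lo} zero z≤n h = refl
  countFrom-skip X {lo} (suc m) p h with m≤n⇒m<n∨m≡n p
  ... | inj₂ refl = refl
  ... | inj₁ (s≤s q) = trans (countFrom-skip X m q (λ u r s → h u r (≤-trans s (n≤1+n m)))) last
    where
    last : countFrom X m ≡ countFrom X (suc m)
    last with m ≤? n
    ... | yes m≤n rewrite countFrom-step X m m≤n | h m q ≤-refl = refl
    ... | no m≰n rewrite countFrom-beyond X m (≰⇒> m≰n) | countFrom-beyond X (suc m) (≤-trans (≰⇒> m≰n) (n≤1+n m)) = refl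

  countFrom-≤-below : ∀ X Y {lo} m → lo ≤ m → (∀ u → lo ≤ u → u < m → X u ≡ Y u) →
                      countFrom X m ≤ countFrom Y m → countFrom X lo ≤ countFrom Y lo
  countFrom-≤-below X Y {lo} zero z≤n h le = le
  countFrom-≤-below X Y {lo} (suc m) p h le with m≤n⇒m<n∨m≡n p
  ... | inj₂ refl = le
  ... | inj₁ (s≤s q) = countFrom-≤-below X Y m q (λ u r s → h u r (≤-trans s (n≤1+n m))) le′
    where
    le′ : countFrom X m ≤ countFrom Y m
    le′ with m ≤? n
    ... | yes m≤n rewrite countFrom-step X m m≤n | countFrom-step Y m m≤n | h m q ≤-refl = +-monoʳ-≤ (bit (Y m)) le
    ... | no m≰n rewrite countFrom-beyond X m (≰⇒> m≰n) = z≤n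

last-failure : (P : ℕ → Bool) → ∀ n d lo → d + lo ≡ suc n →
  (∀ x → lo ≤ x → x ≤ n → P x ≡ true) ⊎
  (Σ ℕ λ x₀ → lo ≤ x₀ × x₀ ≤ n × P x₀ ≡ false × (∀ x → x₀ < x → x ≤ n → P x ≡ true))
last-failure P n zero lo e = inj₁ (λ x lo≤x x≤n → ⊥-elim (<⇒≱ (s≤s x≤n) (≤-trans (≤-reflexive (sym e)) lo≤x)))
last-failure P n (suc d) lo e with last-failure P n d (suc lo) (trans (+-suc d lo) e)
... | inj₂ (x₀ , lo<x₀ , x₀≤n , Px₀ , above) = inj₂ (x₀ , ≤-trans (n≤1+n lo) lo<x₀ , x₀≤n , Px₀ , above)
... | inj₁ above with P lo in Plo
...   | true = inj₁ all
  where
  all : ∀ x → lo ≤ x → x ≤ n → P x ≡ true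
  all x lo≤x x≤n with m≤n⇒m<n∨m≡n lo≤x
  ... | inj₁ lo<x = above x lo<x x≤n
  ... | inj₂ refl = Plo
...   | false = inj₂ (lo , ≤-refl , ≤-pred (≤-trans (m≤n+m (suc lo) d) (≤-reflexive (trans (+-suc d lo) e))) , Plo , above)

-- The burning process computes the least stable set

copiesOf : ℕ → List Entry → ℕ
copiesOf v [] = 0
copiesOf v ((w , _) ∷ es) = bit (w ≡ᵇ v) + copiesOf v es

copiesOf-++ : ∀ v xs ys → copiesOf v (xs ++ ys) ≡ copiesOf v xs + copiesOf v ys
copiesOf-++ v [] ys = refl
copiesOf-++ v ((w , _) ∷ xs) ys rewrite copiesOf-++ v xs ys = sym (+-assoc (bit (w ≡ᵇ v)) _ _)

TargetsIn : ℕ → List Entry → Set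
TargetsIn n = Allₗ.All (InRange n ∘ proj₁)

does-∈?-∷ʳ : ∀ u B v → does (u ∈? (B ++ [ v ])) ≡ (does (u ∈? B) ∨ (u ≡ᵇ v))
does-∈?-∷ʳ u [] v = ∨-identityʳ (u ≡ᵇ v)
does-∈?-∷ʳ u (x ∷ B) v rewrite does-∈?-∷ʳ u B v = sym (∨-assoc (u ≡ᵇ x) _ _)

burnt : State → ℕ → Bool
burnt s u = isBurnt u s

burnVertex : ℕ → State → State
burnVertex v s = st (State.counter s) (State.burnt s ++ [ v ])

decrement : ℕ → State → State
decrement v (st c B) = st (update c v (c v ∸ 1)) B

record Insert (X X′ : ℕ → Bool) (v : ℕ) : Set where
  field
    absent  : X v ≡ false
    present : X′ v ≡ true
    others  : ∀ u → u ≢ v → X′ u ≡ X u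

burnVertex-burnt : ∀ s v u → burnt (burnVertex v s) u ≡ (burnt s u ∨ (u ≡ᵇ v))
burnVertex-burnt s v u = does-∈?-∷ʳ u (State.burnt s) v

burnVertex-self : ∀ s v → burnt (burnVertex v s) v ≡ true
burnVertex-self s v = trans (burnVertex-burnt s v v) (trans (cong (burnt s v ∨_) (≡ᵇ-refl v)) (∨-zeroʳ _))

burnVertex-others : ∀ s v u → u ≢ v → burnt (burnVertex v s) u ≡ burnt s u
burnVertex-others s v u u≢v = trans (burnVertex-burnt s v u) (trans (cong (burnt s u ∨_) (≢⇒≡ᵇ-false u≢v)) (∨-identityʳ _))

burnVertex-insert : ∀ s v → burnt s v ≡ false → Insert (burnt s) (burnt (burnVertex v s)) v
burnVertex-insert s v v∉s = record { absent = v∉s ; present = burnVertex-self s v ; others = burnVertex-others s v }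

burnVertex-grows : ∀ s v u → burnt s u ≡ true → burnt (burnVertex v s) u ≡ true
burnVertex-grows s v u e = trans (burnVertex-burnt s v u) (cong (_∨ (u ≡ᵇ v)) e)

burnVertex-new : ∀ s v u → burnt (burnVertex v s) u ≡ true → burnt s u ≡ true ⊎ u ≡ v
burnVertex-new s v u e with u ≟ v
... | yes u≡v = inj₂ u≡v
... | no u≢v = inj₁ (trans (sym (burnVertex-others s v u u≢v)) e)

burnt-≢ : ∀ s {u v} → burnt s u ≡ true → burnt s v ≡ false → u ≢ v
burnt-≢ s p q refl = true≢false (trans (sym p) q)

module Burning (n k : ℕ) (targets : ∀ u → TargetsIn n (nbrs n k u)) where

  arcs : ℕ → ℕ → ℕ
  arcs u v = copiesOf v (nbrs n k u)

  indeg : (ℕ → Bool) → ℕ → ℕ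
  indeg X v = sumRange (λ u → if X u then arcs u v else 0) 0 (suc n)

  unburnt : State → ℕ
  unburnt s = countRange (not ∘ burnt s) 0 (suc n)

  within-0 : ∀ {v} → v ≤ n → Within 0 (suc n) v
  within-0 p = z≤n , s≤s p

  indeg-insert : ∀ {X X′ v} w → v ≤ n → Insert X X′ v → indeg X′ w ≡ indeg X w + arcs v w
  indeg-insert {X} {X′} {v} w v≤n ins =
    sumRange-update _ _ v (arcs v w) 0 (suc n) (within-0 v≤n)
      (λ u u≢v → cong (λ b → if b then arcs u w else 0) (others u u≢v))
      (trans (cong (λ b → if b then arcs v w else 0) present)
             (cong (λ b → (if b then arcs v w else 0) + arcs v w) (sym absent)))
    where open Insert ins

  complement-insert : ∀ {X X′ v} → v ≤ n → Insert X X′ v →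
    countRange (not ∘ X) 0 (suc n) ≡ countRange (not ∘ X′) 0 (suc n) + 1
  complement-insert {X} {X′} {v} v≤n ins =
    sumRange-update (bit ∘ not ∘ X′) (bit ∘ not ∘ X) v 1 0 (suc n) (within-0 v≤n)
      (λ u u≢v → cong (bit ∘ not) (sym (others u u≢v)))
      (trans (cong (bit ∘ not) absent) (cong (λ b → bit (not b) + 1) (sym present)))
    where open Insert ins

  Bounded : State → Set
  Bounded s = ∀ u → burnt s u ≡ true → u ≤ n

  -- R lists the arcs still to be scanned by the pending calls of DFS_FROM.
  StabilityInvariant : (ℕ → ℕ) → State → List Entry → Set
  StabilityInvariant A s R = ∀ v → 1 ≤ v → v ≤ n → burnt s v ≡ false →
    1 ≤ State.counter s v × State.counter s v + indeg (burnt s) v ≤ A v + copiesOf v R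

  record Progress (A : ℕ → ℕ) (s : State) (R : List Entry) (s′ : State) : Set where
    field
      invariant : StabilityInvariant A s′ R
      bounded   : Bounded s′
      grows     : ∀ u → burnt s u ≡ true → burnt s′ u ≡ true
      unburnt-≤ : unburnt s′ ≤ unburnt s

  stability-skip : ∀ A s v m R → burnt s v ≡ true →
    StabilityInvariant A s ((v , m) ∷ R) → StabilityInvariant A s R
  stability-skip A s v m R v∈s inv w w1 wn w∉s with inv w w1 wn w∉s
  ... | c1 , le rewrite ≢⇒≡ᵇ-false (burnt-≢ s v∈s w∉s) = c1 , le

  stability-decrement : ∀ A s v m R → does (State.counter s v ≟ 1) ≡ false →
    StabilityInvariant A s ((v , m) ∷ R) → StabilityInvariant A (decrement v s) R
  stability-decrement A s v m R c≢1 inv w w1 wn w∉s with w ≟ v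
  ... | no w≢v rewrite ≢⇒≡ᵇ-false w≢v with inv w w1 wn w∉s
  ...   | c1 , le rewrite ≢⇒≡ᵇ-false (w≢v ∘ sym) = c1 , le
  stability-decrement A s v m R c≢1 inv w w1 wn w∉s | yes refl rewrite ≡ᵇ-refl w =
    ∸-monoˡ-≤ 1 c≥2 , +-cancelˡ-≤ 1 _ _ (begin
      1 + (c w ∸ 1 + S)      ≡⟨ +-assoc 1 (c w ∸ 1) S ⟨
      1 + (c w ∸ 1) + S      ≡⟨ cong (_+ S) (m+[n∸m]≡n (≤-trans (s≤s z≤n) c≥2)) ⟩
      c w + S                ≤⟨ subst (λ z → c w + S ≤ A w + (bit z + copiesOf w R)) (≡ᵇ-refl w) le ⟩
      A w + (1 + copiesOf w R) ≡⟨ +-assoc (A w) 1 _ ⟨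
      A w + 1 + copiesOf w R   ≡⟨ cong (_+ copiesOf w R) (+-comm (A w) 1) ⟩
      1 + A w + copiesOf w R   ≡⟨ +-assoc 1 (A w) _ ⟩
      1 + (A w + copiesOf w R) ∎)
    where
    open ≤-Reasoning
    c = State.counter s
    S = indeg (burnt s) w
    c≥1 = proj₁ (inv w w1 wn w∉s)
    le = proj₂ (inv w w1 wn w∉s)
    c≥2 : 2 ≤ c w
    c≥2 with m≤n⇒m<n∨m≡n c≥1
    ... | inj₁ p = p
    ... | inj₂ p rewrite sym p = ⊥-elim (true≢false c≢1)

  stability-burn : ∀ A s v m R → v ≤ n → burnt s v ≡ false →
    StabilityInvariant A s ((v , m) ∷ R) → StabilityInvariant A (burnVertex v s) (nbrs n k v ++ R)
  stability-burn A s v m R vn v∉s inv w w1 wn w∉s′ = c1 , goal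
    where
    c = State.counter s
    w≢v : w ≢ v
    w≢v = burnt-≢ (burnVertex v s) (burnVertex-self s v) w∉s′ ∘ sym
    w∉s : burnt s w ≡ false
    w∉s = trans (sym (burnVertex-others s v w w≢v)) w∉s′
    c1 = proj₁ (inv w w1 wn w∉s)
    le : c w + indeg (burnt s) w ≤ A w + copiesOf w R
    le = subst (λ z → c w + indeg (burnt s) w ≤ A w + (bit z + copiesOf w R)) (≢⇒≡ᵇ-false (w≢v ∘ sym)) (proj₂ (inv w w1 wn w∉s))
    goal : c w + indeg (burnt (burnVertex v s)) w ≤ A w + copiesOf w (nbrs n k v ++ R)
    goal rewrite indeg-insert w vn (burnVertex-insert s v v∉s) | copiesOf-++ w (nbrs n k v) R = begin
      c w + (indeg (burnt s) w + arcs v w)   ≡⟨ +-assoc (c w) _ _ ⟨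
      c w + indeg (burnt s) w + arcs v w     ≤⟨ +-monoˡ-≤ (arcs v w) le ⟩
      A w + copiesOf w R + arcs v w          ≡⟨ +-assoc (A w) _ _ ⟩
      A w + (copiesOf w R + arcs v w)        ≡⟨ cong (A w +_) (+-comm _ (arcs v w)) ⟩
      A w + (arcs v w + copiesOf w R)        ∎
      where open ≤-Reasoning

  burnVertex-bounded : ∀ s v → v ≤ n → Bounded s → Bounded (burnVertex v s)
  burnVertex-bounded s v vn bnd u e with burnVertex-new s v u e
  ... | inj₁ u∈s = bnd u u∈s
  ... | inj₂ refl = vn

  mutual
    dfsFrom-progress : ∀ A f v s R → suc (unburnt s) ≤ f → Bounded s →
      StabilityInvariant A s (nbrs n k v ++ R) → Progress A s R (dfsFrom n k f v s)
    dfsFrom-progress A (suc f) v s R fuel bnd inv = goList-progress A f (nbrs n k v) s R (targets v) (≤-pred fuel) bnd inv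

    goList-progress : ∀ A f es s R → TargetsIn n es → unburnt s ≤ f → Bounded s →
      StabilityInvariant A s (es ++ R) → Progress A s R (goList n k f es s)
    goList-progress A f [] s R _ fuel bnd inv = record { invariant = inv ; bounded = bnd ; grows = λ _ e → e ; unburnt-≤ = ≤-refl }
    goList-progress A f ((v , m) ∷ es) s R ((v1 , vn) ∷ ok) fuel bnd inv =
      let p₁ = visit-progress A f v m s (es ++ R) vn fuel bnd inv
          p₂ = goList-progress A f es (visit n k f v s) R ok (≤-trans (Progress.unburnt-≤ p₁) fuel) (Progress.bounded p₁) (Progress.invariant p₁)
      in record
        { invariant = Progress.invariant p₂
        ; bounded   = Progress.bounded p₂
        ; grows     = λ u e → Progress.grows p₂ u (Progress.grows p₁ u e)
        ; unburnt-≤ = ≤-trans (Progress.unburnt-≤ p₂) (Progress.unburnt-≤ p₁)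
        }

    visit-progress : ∀ A f v m s R → v ≤ n → unburnt s ≤ f → Bounded s →
      StabilityInvariant A s ((v , m) ∷ R) → Progress A s R (visit n k f v s)
    visit-progress A f v m s R vn fuel bnd inv with isBurnt v s in v∈s
    ... | true = record { invariant = stability-skip A s v m R v∈s inv ; bounded = bnd ; grows = λ _ e → e ; unburnt-≤ = ≤-refl }
    ... | false with does (State.counter s v ≟ 1) in c≟1
    ...   | false = record { invariant = stability-decrement A s v m R c≟1 inv ; bounded = bnd ; grows = λ _ e → e ; unburnt-≤ = ≤-refl }
    ...   | true =
      let p = dfsFrom-progress A f v s′ R fuel′ (burnVertex-bounded s v vn bnd) (stability-burn A s v m R vn v∈s inv)
      in record
        { invariant = Progress.invariant p
        ; bounded   = Progress.bounded p
        ; grows     = λ u e → Progress.grows p u (burnVertex-grows s v u e)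
        ; unburnt-≤ = ≤-trans (Progress.unburnt-≤ p) (≤-trans (m≤m+n (unburnt s′) 1) (≤-reflexive (sym one-less)))
        }
      where
      s′ = burnVertex v s
      one-less : unburnt s ≡ unburnt s′ + 1
      one-less = complement-insert vn (burnVertex-insert s v v∈s)
      fuel′ : suc (unburnt s′) ≤ f
      fuel′ = ≤-trans (≤-reflexive (trans (+-comm 1 (unburnt s′)) (sym one-less))) fuel

  module Minimality (C : ℕ → Bool) where

    unburntIn : State → ℕ → Bool
    unburntIn s u = C u ∧ not (burnt s u)

    MinimalityInvariant : State → List Entry → Set
    MinimalityInvariant s R =
      (∀ u → burnt s u ≡ true → C u ≡ true) ×
      (∀ v → 1 ≤ v → v ≤ n → C v ≡ false → suc (copiesOf v R + indeg (unburntIn s) v) ≤ State.counter s v)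

    minimality-drop : ∀ s xs R → MinimalityInvariant s (xs ++ R) → MinimalityInvariant s R
    minimality-drop s xs R (⊆C , h) = ⊆C , λ v v1 vn v∉C →
      ≤-trans (s≤s (+-monoˡ-≤ _ (≤-trans (m≤n+m (copiesOf v R) (copiesOf v xs)) (≤-reflexive (sym (copiesOf-++ v xs R))))))
              (h v v1 vn v∉C)

    minimality-decrement : ∀ s v m R → MinimalityInvariant s ((v , m) ∷ R) → MinimalityInvariant (decrement v s) R
    minimality-decrement s v m R (⊆C , h) = ⊆C , h′
      where
      c = State.counter s
      h′ : ∀ w → 1 ≤ w → w ≤ n → C w ≡ false → suc (copiesOf w R + indeg (unburntIn s) w) ≤ update c v (c v ∸ 1) w
      h′ w w1 wn w∉C with w ≟ v
      ... | yes refl rewrite ≡ᵇ-refl w =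
        +-cancelˡ-≤ 1 _ _ (≤-trans (subst (λ z → suc (bit z + copiesOf w R + indeg (unburntIn s) w) ≤ c w) (≡ᵇ-refl w) (h w w1 wn w∉C))
                                   (≤-reflexive (sym (m+[n∸m]≡n {1} {c w} (≤-trans (s≤s z≤n) (h w w1 wn w∉C))))))
      ... | no w≢v rewrite ≢⇒≡ᵇ-false w≢v =
        subst (λ z → suc (bit z + copiesOf w R + indeg (unburntIn s) w) ≤ c w) (≢⇒≡ᵇ-false (w≢v ∘ sym)) (h w w1 wn w∉C)

    -- A vertex outside C never reaches counter 1, so only vertices of C burn.
    minimality-burn : ∀ s v m R → 1 ≤ v → v ≤ n → burnt s v ≡ false → does (State.counter s v ≟ 1) ≡ true →
      MinimalityInvariant s ((v , m) ∷ R) → MinimalityInvariant (burnVertex v s) (nbrs n k v ++ R)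
    minimality-burn s v m R v1 vn v∉s c≡1 (⊆C , h) = ⊆C′ , h′
      where
      c = State.counter s
      v∈C : C v ≡ true
      v∈C with C v in e
      ... | true = refl
      ... | false = ⊥-elim (<-irrefl refl (≤-trans two (≤-trans (h v v1 vn e) (≤-reflexive (≡ᵇ-true⇒≡ c≡1)))))
        where
        two : 2 ≤ suc (bit (v ≡ᵇ v) + copiesOf v R + indeg (unburntIn s) v)
        two rewrite ≡ᵇ-refl v = s≤s (s≤s z≤n)
      ⊆C′ : ∀ u → burnt (burnVertex v s) u ≡ true → C u ≡ true
      ⊆C′ u e with burnVertex-new s v u e
      ... | inj₁ u∈s = ⊆C u u∈s
      ... | inj₂ refl = v∈C
      insert : Insert (unburntIn (burnVertex v s)) (unburntIn s) v
      insert = record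
        { absent  = trans (cong (λ b → C v ∧ not b) (burnVertex-self s v)) (∧-zeroʳ (C v))
        ; present = trans (cong (λ b → C v ∧ not b) v∉s) (trans (cong (_∧ true) v∈C) refl)
        ; others  = λ u u≢v → cong (λ b → C u ∧ not b) (sym (burnVertex-others s v u u≢v))
        }
      h′ : ∀ w → 1 ≤ w → w ≤ n → C w ≡ false → suc (copiesOf w (nbrs n k v ++ R) + indeg (unburntIn (burnVertex v s)) w) ≤ c w
      h′ w w1 wn w∉C = subst (λ z → suc z ≤ c w) (sym same)
        (subst (λ z → suc (bit z + copiesOf w R + indeg (unburntIn s) w) ≤ c w) (≢⇒≡ᵇ-false v≢w) (h w w1 wn w∉C))
        where
        v≢w : v ≢ w
        v≢w refl = true≢false (trans (sym v∈C) w∉C)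
        same : copiesOf w (nbrs n k v ++ R) + indeg (unburntIn (burnVertex v s)) w ≡ 0 + copiesOf w R + indeg (unburntIn s) w
        same rewrite copiesOf-++ w (nbrs n k v) R | indeg-insert w vn insert =
          trans (+-assoc (arcs v w) _ _) (trans (+-comm (arcs v w) _) (+-assoc (copiesOf w R) _ _))

    mutual
      dfsFrom-minimal : ∀ f v s R → MinimalityInvariant s (nbrs n k v ++ R) → MinimalityInvariant (dfsFrom n k f v s) R
      dfsFrom-minimal zero v s R inv = minimality-drop s (nbrs n k v) R inv
      dfsFrom-minimal (suc f) v s R inv = goList-minimal f (nbrs n k v) s R (targets v) inv

      goList-minimal : ∀ f es s R → TargetsIn n es → MinimalityInvariant s (es ++ R) → MinimalityInvariant (goList n k f es s) R
      goList-minimal f [] s R _ inv = inv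
      goList-minimal f ((v , m) ∷ es) s R ((v1 , vn) ∷ ok) inv =
        goList-minimal f es (visit n k f v s) R ok (visit-minimal f v m s (es ++ R) v1 vn inv)

      visit-minimal : ∀ f v m s R → 1 ≤ v → v ≤ n → MinimalityInvariant s ((v , m) ∷ R) → MinimalityInvariant (visit n k f v s) R
      visit-minimal f v m s R v1 vn inv with isBurnt v s in v∈s
      ... | true = minimality-drop s [ (v , m) ] R inv
      ... | false with does (State.counter s v ≟ 1) in c≟1
      ...   | true = dfsFrom-minimal f v (burnVertex v s) R (minimality-burn s v m R v1 vn v∈s c≟1 inv)
      ...   | false = minimality-decrement s v m R inv

  Stable : (ℕ → ℕ) → (ℕ → Bool) → Set
  Stable A X = ∀ v → 1 ≤ v → v ≤ n → X v ≡ false → indeg X v < A v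

  module Outcome (A : ℕ → ℕ) (A≥1 : ∀ v → 1 ≤ v → v ≤ n → 1 ≤ A v) where

    initial : State
    initial = st A [ 0 ]

    final : State
    final = dfsFrom n k (suc (suc n)) 0 initial

    root-insert : Insert (λ _ → false) (burnt initial) 0
    root-insert = record
      { absent = refl ; present = refl
      ; others = λ u u≢0 → trans (∨-identityʳ _) (≢⇒≡ᵇ-false u≢0) }

    indeg-initial : ∀ v → indeg (burnt initial) v ≡ arcs 0 v
    indeg-initial v = trans (indeg-insert v z≤n root-insert) (cong (_+ arcs 0 v) (sumRange-const0 0 (suc n)))

    initial-invariant : StabilityInvariant A initial (nbrs n k 0 ++ [])
    initial-invariant v v1 vn _ = A≥1 v v1 vn , +-monoʳ-≤ (A v)
      (≤-reflexive (trans (indeg-initial v) (trans (sym (+-identityʳ _)) (sym (copiesOf-++ v (nbrs n k 0) [])))))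

    initial-bounded : Bounded initial
    initial-bounded u e rewrite ≡ᵇ-true⇒≡ {u} {0} (trans (sym (∨-identityʳ _)) e) = z≤n

    progress : Progress A initial [] final
    progress = dfsFrom-progress A (suc (suc n)) 0 initial [] (s≤s (countRange-≤ (not ∘ burnt initial) 0 (suc n))) initial-bounded initial-invariant

    burnt-stable : Stable A (burnt final)
    burnt-stable v v1 vn v∉ = let (c1 , le) = Progress.invariant progress v v1 vn v∉ in
      ≤-trans (+-monoˡ-≤ (indeg (burnt final) v) c1) (≤-trans le (≤-reflexive (+-identityʳ (A v))))

    burnt-≤n : Bounded final
    burnt-≤n = Progress.bounded progress

    burnt-0 : burnt final 0 ≡ true
    burnt-0 = Progress.grows progress 0 refl

    burnt-least : ∀ C → C 0 ≡ true → Stable A C → ∀ u → burnt final u ≡ true → C u ≡ true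
    burnt-least C C0 stable = proj₁ (dfsFrom-minimal (suc (suc n)) 0 initial [] (⊆C , h))
      where
      open Minimality C
      ⊆C : ∀ u → burnt initial u ≡ true → C u ≡ true
      ⊆C u e = subst (λ z → C z ≡ true) (sym (≡ᵇ-true⇒≡ (trans (sym (∨-identityʳ _)) e))) C0
      insert : Insert (unburntIn initial) C 0
      insert = record
        { absent  = ∧-zeroʳ (C 0)
        ; present = C0
        ; others  = λ u u≢0 → trans (sym (∧-identityʳ (C u))) (cong (λ b → C u ∧ not b) (sym (Insert.others root-insert u u≢0)))
        }
      h : ∀ v → 1 ≤ v → v ≤ n → C v ≡ false → suc (copiesOf v (nbrs n k 0 ++ []) + indeg (unburntIn initial) v) ≤ A v
      h v v1 vn v∉C = ≤-trans (≤-reflexive (cong suc same)) (stable v v1 vn v∉C)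
        where
        same : copiesOf v (nbrs n k 0 ++ []) + indeg (unburntIn initial) v ≡ indeg C v
        same rewrite indeg-insert v z≤n insert | copiesOf-++ v (nbrs n k 0) [] | +-identityʳ (arcs 0 v) = +-comm (arcs 0 v) _

-- Arcs of the graph

occurrences : ℕ → List ℕ → ℕ
occurrences v [] = 0
occurrences v (x ∷ xs) = bit (x ≡ᵇ v) + occurrences v xs

occurrences-++ : ∀ v xs ys → occurrences v (xs ++ ys) ≡ occurrences v xs + occurrences v ys
occurrences-++ v [] ys = refl
occurrences-++ v (x ∷ xs) ys rewrite occurrences-++ v xs ys = sym (+-assoc (bit (x ≡ᵇ v)) _ _)

copiesOf-map-copy0 : ∀ v xs → copiesOf v (map copy0 xs) ≡ occurrences v xs
copiesOf-map-copy0 v [] = refl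
copiesOf-map-copy0 v (x ∷ xs) = cong (bit (x ≡ᵇ v) +_) (copiesOf-map-copy0 v xs)

occurrences-absent : ∀ v {P : ℕ → Set} xs → Allₗ.All P xs → (∀ x → P x → x ≢ v) → occurrences v xs ≡ 0
occurrences-absent v [] _ _ = refl
occurrences-absent v (x ∷ xs) (px ∷ pxs) h rewrite ≢⇒≡ᵇ-false (h x px) = occurrences-absent v xs pxs h

copiesOf-copies : ∀ v i (ms : List ℕ) → copiesOf v (map (i ,_) ms) ≡ (if i ≡ᵇ v then length ms else 0)
copiesOf-copies v i [] with i ≡ᵇ v
... | true = refl
... | false = refl
copiesOf-copies v i (m ∷ ms) rewrite copiesOf-copies v i ms with i ≡ᵇ v
... | true = refl
... | false = refl

copiesOf-concatMap : ∀ v (L : ℕ → ℕ) xs →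
  copiesOf v (concatMap (λ i → map (i ,_) (downFrom (L i))) xs) ≡ occurrences v xs * L v
copiesOf-concatMap v L [] = refl
copiesOf-concatMap v L (x ∷ xs)
  rewrite copiesOf-++ v (map (x ,_) (downFrom (L x))) (concatMap (λ i → map (i ,_) (downFrom (L i))) xs)
        | copiesOf-copies v x (downFrom (L x)) | copiesOf-concatMap v L xs with x ≟ v
... | yes refl rewrite ≡ᵇ-refl x | length-downFrom (L x) = refl
... | no x≢v rewrite ≢⇒≡ᵇ-false x≢v = refl

desc-bounds : ∀ lo hi → Allₗ.All (λ x → lo ≤ x × x ≤ hi) (desc lo hi)
desc-bounds lo hi = Allₗ.zipWith (λ (p , q) → p , ≤-pred q)
  (all-filter (lo ≤?_) (downFrom (suc hi)) , filter⁺ (lo ≤?_) (applyDownFrom⁺₁ (λ x → x) (suc hi) (λ i<m → i<m)))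

occurrences-desc-out : ∀ lo hi v → v < lo ⊎ hi < v → occurrences v (desc lo hi) ≡ 0
occurrences-desc-out lo hi v out = occurrences-absent v (desc lo hi) (desc-bounds lo hi) (excluded out)
  where
  excluded : v < lo ⊎ hi < v → ∀ x → lo ≤ x × x ≤ hi → x ≢ v
  excluded (inj₁ v<lo) x (lo≤x , _) refl = <⇒≱ v<lo lo≤x
  excluded (inj₂ hi<v) x (_ , x≤hi) refl = <⇒≱ hi<v x≤hi

occurrences-filter-in : ∀ lo m v → lo ≤ v → v < m → occurrences v (filter (lo ≤?_) (downFrom m)) ≡ 1
occurrences-filter-in lo (suc m) v lo≤v v<1+m with lo ≤ᵇ m in lo≤ᵇm
... | false = ⊥-elim (<⇒≱ (≤ᵇ-false⇒> lo≤ᵇm) (≤-trans lo≤v (≤-pred v<1+m)))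
... | true with m ≟ v
...   | yes refl rewrite ≡ᵇ-refl m =
  cong suc (occurrences-absent m _ (filter⁺ (lo ≤?_) (applyDownFrom⁺₁ (λ x → x) m (λ x<m → x<m))) (λ x x<m → <⇒≢ x<m))
...   | no m≢v rewrite ≢⇒≡ᵇ-false m≢v = occurrences-filter-in lo m v lo≤v (≤∧≢⇒< (≤-pred v<1+m) (m≢v ∘ sym))

occurrences-desc-in : ∀ lo hi v → lo ≤ v → v ≤ hi → occurrences v (desc lo hi) ≡ 1
occurrences-desc-in lo hi v lo≤v v≤hi = occurrences-filter-in lo (suc hi) v lo≤v (s≤s v≤hi)

module Graph (n k : ℕ) (k≥2 : 2 ≤ k) (k≤n : k ≤ n) where

  arcs-from-0 : ∀ v → 1 ≤ v → v ≤ n → copiesOf v (nbrs n k 0) ≡ 1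
  arcs-from-0 v 1≤v v≤n = trans (copiesOf-map-copy0 v (desc 1 n)) (occurrences-desc-in 1 n v 1≤v v≤n)

  arcs-1-1 : copiesOf 1 (nbrs n k 1) ≡ 0
  arcs-1-1 = trans (copiesOf-concatMap 1 _ (desc 2 n)) (cong (_* _) (occurrences-desc-out 2 n 1 (inj₁ ≤-refl)))

  arcs-from-1 : ∀ v → 2 ≤ v → v ≤ n → suc (copiesOf v (nbrs n k 1)) ≡ v ⊓ k
  arcs-from-1 v 2≤v v≤n = begin
    suc (copiesOf v (nbrs n k 1))             ≡⟨ cong suc (copiesOf-concatMap v _ (desc 2 n)) ⟩
    suc (occurrences v (desc 2 n) * L)        ≡⟨ cong (λ c → suc (c * L)) (occurrences-desc-in 2 n v 2≤v v≤n) ⟩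
    suc (L + 0)                               ≡⟨ cong suc (+-identityʳ L) ⟩
    suc L                                     ≡⟨ m+[n∸m]≡n (⊓-glb 2≤v k≥2) ⟩
    v ⊓ k                                     ∎
    where
    open ≡-Reasoning
    L = suc ((v ⊓ k) ∸ 2)

  private
    nbrs-≥2 : ∀ j → suc (suc j) ≤ n → nbrs n k (suc (suc j)) ≡
      map copy0 ((if k ≤ᵇ suc (suc j) then desc (suc (suc (suc j))) n else []) ++ desc 1 (suc j))
    nbrs-≥2 j u≤n with suc (suc j) ≤ᵇ n in u≤ᵇn
    ... | true = refl
    ... | false = ⊥-elim (<⇒≱ (≤ᵇ-false⇒> u≤ᵇn) u≤n)

    occurrences-if : ∀ v b xs → occurrences v (if b then xs else []) ≡ (if b then occurrences v xs else 0)
    occurrences-if v true xs = refl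
    occurrences-if v false xs = refl

    arcs-from-≥2 : ∀ j v → suc (suc j) ≤ n → copiesOf v (nbrs n k (suc (suc j))) ≡
      (if k ≤ᵇ suc (suc j) then occurrences v (desc (suc (suc (suc j))) n) else 0) + occurrences v (desc 1 (suc j))
    arcs-from-≥2 j v u≤n
      rewrite nbrs-≥2 j u≤n
            | copiesOf-map-copy0 v ((if k ≤ᵇ suc (suc j) then desc (suc (suc (suc j))) n else []) ++ desc 1 (suc j))
            | occurrences-++ v (if k ≤ᵇ suc (suc j) then desc (suc (suc (suc j))) n else []) (desc 1 (suc j))
            | occurrences-if v (k ≤ᵇ suc (suc j)) (desc (suc (suc (suc j))) n) = refl

    if-zero : ∀ b {x} → x ≡ 0 → (if b then x else 0) ≡ 0
    if-zero true e = e
    if-zero false e = refl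

  arcs-down : ∀ u v → 2 ≤ u → u ≤ n → 1 ≤ v → v < u → copiesOf v (nbrs n k u) ≡ 1
  arcs-down (suc (suc j)) v (s≤s (s≤s z≤n)) u≤n 1≤v v<u
    rewrite arcs-from-≥2 j v u≤n
          | if-zero (k ≤ᵇ suc (suc j)) (occurrences-desc-out (suc (suc (suc j))) n v (inj₁ (≤-trans v<u (n≤1+n _))))
    = occurrences-desc-in 1 (suc j) v 1≤v (≤-pred v<u)

  arcs-loop : ∀ u → 2 ≤ u → u ≤ n → copiesOf u (nbrs n k u) ≡ 0
  arcs-loop (suc (suc j)) (s≤s (s≤s z≤n)) u≤n
    rewrite arcs-from-≥2 j (suc (suc j)) u≤n
          | if-zero (k ≤ᵇ suc (suc j)) (occurrences-desc-out (suc (suc (suc j))) n (suc (suc j)) (inj₁ ≤-refl))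
    = occurrences-desc-out 1 (suc j) (suc (suc j)) (inj₂ ≤-refl)

  arcs-up : ∀ u v → 2 ≤ u → u ≤ n → u < v → v ≤ n → copiesOf v (nbrs n k u) ≡ bit (k ≤ᵇ u)
  arcs-up (suc (suc j)) v (s≤s (s≤s z≤n)) u≤n u<v v≤n
    rewrite arcs-from-≥2 j v u≤n | occurrences-desc-out 1 (suc j) v (inj₂ (≤-trans (n≤1+n _) u<v))
    with k ≤ᵇ suc (suc j)
  ... | true = cong (_+ 0) (occurrences-desc-in (suc (suc (suc j))) n v u<v v≤n)
  ... | false = refl

  nbrs-targets : ∀ u → TargetsIn n (nbrs n k u)
  nbrs-targets zero = map⁺ (desc-bounds 1 n)
  nbrs-targets (suc zero) = concat⁺ (map⁺ (Allₗ.map (λ (2≤i , i≤n) → map⁺ (Allₗ.universal (λ _ → ≤-trans (s≤s z≤n) 2≤i , i≤n) _)) (desc-bounds 2 n)))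
  nbrs-targets (suc (suc j)) with suc (suc j) ≤ᵇ n in u≤ᵇn
  ... | false = []
  ... | true = map⁺ (++⁺ upper (Allₗ.map (λ (p , q) → p , ≤-trans q j<n) (desc-bounds 1 (suc j))))
    where
    j<n : suc j ≤ n
    j<n = ≤-trans (n≤1+n _) (≤ᵇ-true⇒≤ u≤ᵇn)
    upper : Allₗ.All (InRange n) (if k ≤ᵇ suc (suc j) then desc (suc (suc (suc j))) n else [])
    upper with k ≤ᵇ suc (suc j)
    ... | true = Allₗ.map (λ (p , q) → ≤-trans (s≤s z≤n) p , q) (desc-bounds (suc (suc (suc j))) n)
    ... | false = []

  open Burning n k nbrs-targets public
  open Tail n public

  private
    n≥2 : 2 ≤ n
    n≥2 = ≤-trans k≥2 k≤n

    from : (ℕ → Bool) → ℕ → ℕ → ℕ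
    from X v u = if X u then arcs u v else 0

    if-bit : ∀ a b {x} → x ≡ bit b → (if a then x else 0) ≡ bit (a ∧ b)
    if-bit true b e = e
    if-bit false b e = refl

    indeg-split : ∀ X v → indeg X v ≡ from X v 0 + (from X v 1 + 0) + sumRange (from X v) 2 (suc n ∸ 2)
    indeg-split X v = trans (cong (sumRange (from X v) 0) (sym (m+[n∸m]≡n (≤-trans n≥2 (n≤1+n n)))))
                            (sumRange-split (from X v) 0 2 (suc n ∸ 2))

    indeg-tail : ∀ X v (Y : ℕ → Bool) → (∀ u → 2 ≤ u → u ≤ n → from X v u ≡ bit (Y u)) →
                 sumRange (from X v) 2 (suc n ∸ 2) ≡ countFrom Y 2
    indeg-tail X v Y h = sumRange-cong _ _ 2 _ (λ u r → let (p , q) = within⇒bounds r in h u p q)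

    -- The root 0 sends one arc to v and, when 1 ∈ X, vertex 1 adds its min(v,k) − 1 copies.
    indeg-root : ∀ X v → X 0 ≡ true → 2 ≤ v → v ≤ n → from X v 0 + (from X v 1 + 0) ≡ (if X 1 then v ⊓ k else 1)
    indeg-root X v X0 2≤v v≤n rewrite X0 | arcs-from-0 v (≤-trans (s≤s z≤n) 2≤v) v≤n | +-identityʳ (from X v 1) with X 1
    ... | true = arcs-from-1 v 2≤v v≤n
    ... | false = refl

  indeg-1 : ∀ X → X 0 ≡ true → indeg X 1 ≡ suc (countFrom X 2)
  indeg-1 X X0 = begin
    indeg X 1                                                        ≡⟨ indeg-split X 1 ⟩
    from X 1 0 + (from X 1 1 + 0) + sumRange (from X 1) 2 (suc n ∸ 2) ≡⟨ cong₂ _+_ root (indeg-tail X 1 X down) ⟩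
    suc (countFrom X 2)                                              ∎
    where
    open ≡-Reasoning
    root : from X 1 0 + (from X 1 1 + 0) ≡ 1
    root rewrite X0 | arcs-from-0 1 ≤-refl (≤-trans (s≤s z≤n) n≥2) | if-zero (X 1) arcs-1-1 = refl
    down : ∀ u → 2 ≤ u → u ≤ n → from X 1 u ≡ bit (X u)
    down u 2≤u u≤n = trans (if-bit (X u) true (arcs-down u 1 2≤u u≤n ≤-refl 2≤u)) (cong bit (∧-identityʳ (X u)))

  indeg-small : ∀ X v → X 0 ≡ true → 2 ≤ v → v < k → indeg X v ≡ (if X 1 then v else 1) + countFrom X (suc v)
  indeg-small X v X0 2≤v v<k = begin
    indeg X v                                                        ≡⟨ indeg-split X v ⟩
    from X v 0 + (from X v 1 + 0) + sumRange (from X v) 2 (suc n ∸ 2) ≡⟨ cong₂ _+_ root (indeg-tail X v Y (λ u 2≤u u≤n → if-bit (X u) _ (arcs-to-v u 2≤u u≤n))) ⟩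
    (if X 1 then v else 1) + countFrom Y 2                            ≡⟨ cong ((if X 1 then v else 1) +_) count ⟩
    (if X 1 then v else 1) + countFrom X (suc v)                      ∎
    where
    open ≡-Reasoning
    v≤n = ≤-trans (<⇒≤ v<k) k≤n
    Y : ℕ → Bool
    Y u = X u ∧ (v <ᵇ u)
    root : from X v 0 + (from X v 1 + 0) ≡ (if X 1 then v else 1)
    root = trans (indeg-root X v X0 2≤v v≤n) (cong (λ z → if X 1 then z else 1) (m≤n⇒m⊓n≡m (<⇒≤ v<k)))
    arcs-to-v : ∀ u → 2 ≤ u → u ≤ n → copiesOf v (nbrs n k u) ≡ bit (v <ᵇ u)
    arcs-to-v u 2≤u u≤n with <-cmp v u
    ... | tri< v<u _ _ = trans (arcs-down u v 2≤u u≤n (≤-trans (s≤s z≤n) 2≤v) v<u) (cong bit (sym (<⇒<ᵇ-true v<u)))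
    ... | tri≈ _ refl _ = trans (arcs-loop u 2≤u u≤n) (cong bit (sym (≮⇒<ᵇ-false {u} (<-irrefl refl))))
    ... | tri> _ _ u<v = trans (arcs-up u v 2≤u u≤n u<v v≤n) (trans (cong bit (>⇒≤ᵇ-false (<-trans u<v v<k))) (cong bit (sym (≮⇒<ᵇ-false (<⇒≯ u<v)))))
    count : countFrom Y 2 ≡ countFrom X (suc v)
    count = trans (countFrom-skip Y (suc v) (≤-trans 2≤v (n≤1+n v)) (λ u _ u≤v → trans (cong (X u ∧_) (≮⇒<ᵇ-false (≤⇒≯ (≤-pred u≤v)))) (∧-zeroʳ _)))
                  (countFrom-cong Y X (suc v) (λ u v<u _ → trans (cong (X u ∧_) (<⇒<ᵇ-true v<u)) (∧-identityʳ _)))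

  indeg-large : ∀ X v → X 0 ≡ true → k ≤ v → v ≤ n → X v ≡ false → indeg X v ≡ (if X 1 then k else 1) + countFrom X k
  indeg-large X v X0 k≤v v≤n v∉X = begin
    indeg X v                                                        ≡⟨ indeg-split X v ⟩
    from X v 0 + (from X v 1 + 0) + sumRange (from X v) 2 (suc n ∸ 2) ≡⟨ cong₂ _+_ root (indeg-tail X v Y tail) ⟩
    (if X 1 then k else 1) + countFrom Y 2                            ≡⟨ cong ((if X 1 then k else 1) +_) count ⟩
    (if X 1 then k else 1) + countFrom X k                            ∎
    where
    open ≡-Reasoning
    2≤v = ≤-trans k≥2 k≤v
    Y : ℕ → Bool
    Y u = X u ∧ (k ≤ᵇ u)
    root : from X v 0 + (from X v 1 + 0) ≡ (if X 1 then k else 1)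
    root = trans (indeg-root X v X0 2≤v v≤n) (cong (λ z → if X 1 then z else 1) (m≥n⇒m⊓n≡n k≤v))
    tail : ∀ u → 2 ≤ u → u ≤ n → from X v u ≡ bit (Y u)
    tail u 2≤u u≤n with <-cmp v u
    ... | tri< v<u _ _ = if-bit (X u) _ (trans (arcs-down u v 2≤u u≤n (≤-trans (s≤s z≤n) 2≤v) v<u) (cong bit (sym (≤⇒≤ᵇ-true (≤-trans k≤v (<⇒≤ v<u))))))
    ... | tri≈ _ refl _ rewrite v∉X = refl
    ... | tri> _ _ u<v = if-bit (X u) _ (arcs-up u v 2≤u u≤n u<v v≤n)
    count : countFrom Y 2 ≡ countFrom X k
    count = trans (countFrom-skip Y k k≥2 (λ u _ u<k → trans (cong (X u ∧_) (>⇒≤ᵇ-false u<k)) (∧-zeroʳ _)))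
                  (countFrom-cong Y X k (λ u k≤u _ → trans (cong (X u ∧_) (≤⇒≤ᵇ-true k≤u)) (∧-identityʳ _)))

-- Parking and Hall's condition

findFree-≥ : ∀ f occ p → p ≤ findFree f occ p
findFree-≥ zero occ p = ≤-refl
findFree-≥ (suc f) occ p with p ∈? occ
... | yes _ = ≤-trans (n≤1+n p) (findFree-≥ f occ (suc p))
... | no _ = ≤-refl

findFree-passes-occupied : ∀ f occ p q → p ≤ q → q < findFree f occ p → q ∈ occ
findFree-passes-occupied zero occ p q p≤q q<p = ⊥-elim (<⇒≱ q<p p≤q)
findFree-passes-occupied (suc f) occ p q p≤q q<ff with p ∈? occ
... | no _ = ⊥-elim (<⇒≱ q<ff p≤q)
... | yes p∈occ with p ≟ q
...   | yes refl = p∈occ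
...   | no p≢q = findFree-passes-occupied f occ (suc p) q (≤∧≢⇒< p≤q p≢q) q<ff

findFree-free : ∀ f occ p → ¬ (findFree f occ p ∈ occ) ⊎ findFree f occ p ≡ f + p
findFree-free zero occ p = inj₂ refl
findFree-free (suc f) occ p with p ∈? occ
... | no p∉occ = inj₁ p∉occ
... | yes _ with findFree-free f occ (suc p)
...   | inj₁ free = inj₁ free
...   | inj₂ e = inj₂ (trans e (+-suc f p))

RunEndingBelow : (ℕ → Set) → ℕ → Set
RunEndingBelow P m = Σ ℕ λ j → 1 ≤ j × j ≤ m × (∀ q → j ≤ q → q < m → P q) × (j ≡ 1 ⊎ ¬ P (pred j))

runEndingBelow : (P : ℕ → Set) → (∀ q → Dec (P q)) → ∀ m → 1 ≤ m → RunEndingBelow P m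
runEndingBelow P P? (suc zero) _ = 1 , ≤-refl , ≤-refl , (λ q 1≤q q<1 → ⊥-elim (<⇒≱ q<1 1≤q)) , inj₁ refl
runEndingBelow P P? (suc (suc m)) _ with P? (suc m) | runEndingBelow P P? (suc m) (s≤s z≤n)
... | no ¬P | _ = suc (suc m) , s≤s z≤n , ≤-refl , (λ q j≤q q<j → ⊥-elim (<⇒≱ q<j j≤q)) , inj₂ ¬P
... | yes Pm | j , 1≤j , j≤m , run , start = j , 1≤j , ≤-trans j≤m (n≤1+n _) , run′ , start
  where
  run′ : ∀ q → j ≤ q → q < suc (suc m) → P q
  run′ q j≤q q<m with m≤n⇒m<n∨m≡n (≤-pred q<m)
  ... | inj₁ q<1+m = run q j≤q q<1+m
  ... | inj₂ refl = Pm

module Parking (n : ℕ) (a : Vec ℕ n) where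

  open Tail n

  A : ℕ → ℕ
  A = at a

  place : List (ℕ × ℕ) → ℕ → List (ℕ × ℕ)
  place t i = (i , findFree (suc n) (map proj₂ t) (A i)) ∷ t

  -- the table after the d cars n, n − 1, …, n − d + 1 have parked
  table : ℕ → List (ℕ × ℕ)
  table zero = []
  table (suc d) = place (table d) (n ∸ d)

  foldl-place : ∀ m d → m + d ≡ n → foldl place (table d) (desc 1 m) ≡ table n
  foldl-place zero d e = cong table e
  foldl-place (suc m) d e = trans (cong (λ z → foldl place (place (table d) z) (desc 1 m)) next)
                                  (foldl-place m (suc d) (trans (+-suc m d) e))
    where
    next : suc m ≡ n ∸ d
    next = sym (trans (cong (_∸ d) (sym e)) (m+n∸n≡m (suc m) d))

  parkTable≡table : parkTable n a ≡ table n
  parkTable≡table = foldl-place n 0 (+-identityʳ n)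

  occupied : ℕ → List ℕ
  occupied c = map proj₂ (table (n ∸ c))

  spot : ℕ → ℕ
  spot c = findFree (suc n) (occupied c) (A c)

  private
    head-spot : ∀ d → d ≤ n → findFree (suc n) (map proj₂ (table d)) (A (n ∸ d)) ≡ spot (n ∸ d)
    head-spot d d≤n = cong (λ z → findFree (suc n) (map proj₂ (table z)) (A (n ∸ d))) (sym (m∸[m∸n]≡n d≤n))

    lookup-table : ∀ c d → n ∸ c < d → d ≤ n → c ≤ n → lookupPP (table d) c ≡ spot c
    lookup-table c (suc d) n∸c≤d 1+d≤n c≤n with c ≟ (n ∸ d)
    ... | yes refl rewrite ≡ᵇ-refl (n ∸ d) = head-spot d (≤-trans (n≤1+n d) 1+d≤n)
    ... | no c≢n∸d rewrite ≢⇒≡ᵇ-false c≢n∸d = lookup-table c d n∸c<d (≤-trans (n≤1+n d) 1+d≤n) c≤n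
      where
      n∸c<d : n ∸ c < d
      n∸c<d with m≤n⇒m<n∨m≡n (≤-pred n∸c≤d)
      ... | inj₁ p = p
      ... | inj₂ p = ⊥-elim (c≢n∸d (trans (sym (m∸[m∸n]≡n c≤n)) (cong (n ∸_) p)))

    ∸-suc-≤ : ∀ m d → m ∸ d ≤ suc (m ∸ suc d)
    ∸-suc-≤ zero zero = z≤n
    ∸-suc-≤ zero (suc d) = z≤n
    ∸-suc-≤ (suc m) zero = ≤-refl
    ∸-suc-≤ (suc m) (suc d) = ∸-suc-≤ m d

    table-sound : ∀ d q → d ≤ n → q ∈ map proj₂ (table d) → Σ ℕ λ c → n ∸ d < c × c ≤ n × spot c ≡ q
    table-sound (suc d) q d≤n (here refl) = n ∸ d , ∸-monoʳ-< ≤-refl d≤n , m∸n≤m n d , sym (head-spot d (≤-trans (n≤1+n d) d≤n))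
    table-sound (suc d) q d≤n (there q∈) = let (c , p , c≤n , e) = table-sound d q (≤-trans (n≤1+n d) d≤n) q∈ in
      c , ≤-trans (s≤s (∸-monoʳ-≤ n (n≤1+n d))) p , c≤n , e

    table-complete : ∀ d c → d ≤ n → n ∸ d < c → c ≤ n → spot c ∈ map proj₂ (table d)
    table-complete zero c _ n<c c≤n = ⊥-elim (<⇒≱ n<c c≤n)
    table-complete (suc d) c d≤n p c≤n with c ≟ (n ∸ d)
    ... | yes refl = here (sym (head-spot d (≤-trans (n≤1+n d) d≤n)))
    ... | no c≢ = there (table-complete d c (≤-trans (n≤1+n d) d≤n) (≤∧≢⇒< (≤-trans (∸-suc-≤ n d) p) (c≢ ∘ sym)) c≤n)

  pp≡spot : ∀ c → 1 ≤ c → c ≤ n → pp n a c ≡ spot c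
  pp≡spot c 1≤c c≤n = trans (cong (λ t → lookupPP t c) parkTable≡table) (lookup-table c n (∸-monoʳ-< {n} {c} {0} 1≤c c≤n) ≤-refl c≤n)

  occupied⇒later : ∀ c q → c ≤ n → q ∈ occupied c → Σ ℕ λ c′ → c < c′ × c′ ≤ n × spot c′ ≡ q
  occupied⇒later c q c≤n q∈ = let (c′ , p , c′≤n , e) = table-sound (n ∸ c) q (m∸n≤m n c) q∈ in
    c′ , subst (_< c′) (m∸[m∸n]≡n c≤n) p , c′≤n , e

  later⇒occupied : ∀ c c′ → c < c′ → c′ ≤ n → spot c′ ∈ occupied c
  later⇒occupied c c′ c<c′ c′≤n =
    table-complete (n ∸ c) c′ (m∸n≤m n c) (subst (_< c′) (sym (m∸[m∸n]≡n (≤-trans (<⇒≤ c<c′) c′≤n))) c<c′) c′≤n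

  spot-free : ∀ c → spot c ≤ n → ¬ (spot c ∈ occupied c)
  spot-free c spot≤n with findFree-free (suc n) (occupied c) (A c)
  ... | inj₁ free = free
  ... | inj₂ e = ⊥-elim (<⇒≱ (≤-trans (s≤s (m≤m+n n (A c))) (≤-reflexive (sym e))) spot≤n)

  spot-injective : ∀ c c′ → c < c′ → c′ ≤ n → spot c ≤ n → spot c ≢ spot c′
  spot-injective c c′ c<c′ c′≤n spot≤n e = spot-free c spot≤n (subst (_∈ occupied c) (sym e) (later⇒occupied c c′ c<c′ c′≤n))

  module Hall (k : ℕ) (k≥1 : 1 ≤ k) (A≥1 : ∀ v → 1 ≤ v → v ≤ n → 1 ≤ A v) (A≤n : ∀ v → 1 ≤ v → v ≤ n → A v ≤ n) where

    ParksAll : Set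
    ParksAll = ∀ c → k ≤ c → c ≤ n → spot c ≤ n

    -- More cars of W ∩ [k, n], all preferring spots ≥ j, than there are spots in [j, n].
    Overload : ℕ → (ℕ → Bool) → Set
    Overload j W = j ≤ suc n × (∀ v → k ≤ v → v ≤ n → W v ≡ true → j ≤ A v) × suc (suc n) ≤ countFrom W k + j

    parks⇒¬overload : ParksAll → ∀ j W → ¬ Overload j W
    parks⇒¬overload parks j W (j≤1+n , W≥j , many) = <⇒≱ many (begin
      countFrom W k + j  ≤⟨ +-monoˡ-≤ j (countRange-injection W spot k _ j _ into injective) ⟩
      suc n ∸ j + j      ≡⟨ m∸n+n≡m j≤1+n ⟩
      suc n              ∎)
      where
      open ≤-Reasoning
      into : ∀ c → Within k (suc n ∸ k) c → W c ≡ true → Within j (suc n ∸ j) (spot c)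
      into c r Wc = let (k≤c , c≤n) = within⇒bounds r in
        bounds⇒within (≤-trans (W≥j c k≤c c≤n Wc) (findFree-≥ (suc n) (occupied c) (A c))) (parks c k≤c c≤n)
      injective : ∀ u w → Within k (suc n ∸ k) u → Within k (suc n ∸ k) w → W u ≡ true → W w ≡ true → spot u ≡ spot w → u ≡ w
      injective u w ru rw _ _ e with <-cmp u w
      ... | tri≈ _ u≡w _ = u≡w
      ... | tri< u<w _ _ = ⊥-elim (spot-injective u w u<w (proj₂ (within⇒bounds rw)) (parks u (proj₁ (within⇒bounds ru)) (proj₂ (within⇒bounds ru))) e)
      ... | tri> _ _ w<u = ⊥-elim (spot-injective w u w<u (proj₂ (within⇒bounds ru)) (parks w (proj₁ (within⇒bounds rw)) (proj₂ (within⇒bounds rw))) (sym e))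

    -- A car c that does not park finds [A c, n] occupied; extending this run of occupied
    -- spots down to its start j, the cars from c on that park in [j, n] overload it.
    module Unparked (c : ℕ) (k≤c : k ≤ c) (c≤n : c ≤ n) (n<spot : n < spot c) where

      private
        1≤c = ≤-trans k≥1 k≤c
        run = runEndingBelow (_∈ occupied c) (_∈? occupied c) (A c) (A≥1 c 1≤c c≤n)

      j : ℕ
      j = proj₁ run

      j≤A : j ≤ A c
      j≤A = proj₁ (proj₂ (proj₂ run))

      j≤1+n : j ≤ suc n
      j≤1+n = ≤-trans j≤A (≤-trans (A≤n c 1≤c c≤n) (n≤1+n n))

      [j,n]-occupied : ∀ s → j ≤ s → s ≤ n → s ∈ occupied c
      [j,n]-occupied s j≤s s≤n with s <? A c
      ... | yes s<A = proj₁ (proj₂ (proj₂ (proj₂ run))) s j≤s s<A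
      ... | no s≮A = findFree-passes-occupied (suc n) (occupied c) (A c) s (≮⇒≥ s≮A) (≤-trans (s≤s s≤n) n<spot)

      -- A later car v with A v < j would have passed the free spot j − 1.
      later-prefers-≥j : ∀ v → c < v → v ≤ n → j ≤ spot v → j ≤ A v
      later-prefers-≥j v c<v v≤n j≤spot with j ≤? A v
      ... | yes j≤Av = j≤Av
      ... | no j≰Av = ⊥-elim (not-start (proj₂ (proj₂ (proj₂ (proj₂ run)))))
        where
        Av<j = ≰⇒> j≰Av
        not-start : (j ≡ 1 ⊎ ¬ (pred j ∈ occupied c)) → ⊥
        not-start (inj₁ j≡1) = <⇒≱ Av<j (subst (_≤ A v) (sym j≡1) (A≥1 v (≤-trans 1≤c (<⇒≤ c<v)) v≤n))
        not-start (inj₂ free) with occupied⇒later v (pred j) v≤n passed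
          where
          passed : pred j ∈ occupied v
          passed = findFree-passes-occupied (suc n) (occupied v) (A v) (pred j) (<⇒≤pred Av<j)
                     (≤-trans (≤-reflexive (suc-pred j {{>-nonZero (≤-trans (s≤s z≤n) Av<j)}})) j≤spot)
        ... | c″ , v<c″ , c″≤n , e = free (subst (_∈ occupied c) e (later⇒occupied c c″ (<-trans c<v v<c″) c″≤n))

      W : ℕ → Bool
      W u = (c ≤ᵇ u) ∧ (j ≤ᵇ spot u)

      W≥j : ∀ v → k ≤ v → v ≤ n → W v ≡ true → j ≤ A v
      W≥j v k≤v v≤n Wv with m≤n⇒m<n∨m≡n (≤ᵇ-true⇒≤ {c} {v} (∧-conicalˡ (c ≤ᵇ v) _ Wv))
      ... | inj₂ refl = j≤A
      ... | inj₁ c<v = later-prefers-≥j v c<v v≤n (≤ᵇ-true⇒≤ (∧-conicalʳ (c ≤ᵇ v) _ Wv))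

      W-c : W c ≡ true
      W-c = trans (cong (_∧ (j ≤ᵇ spot c)) (≤⇒≤ᵇ-true (≤-refl {c}))) (≤⇒≤ᵇ-true (≤-trans j≤A (findFree-≥ (suc n) (occupied c) (A c))))

      W-after-c : suc n ∸ j ≤ countFrom W (suc c)
      W-after-c = countRange-surjection W spot (suc c) _ j _ marked onto
        where
        marked : ∀ u → Within (suc c) (suc n ∸ suc c) u → Within j (suc n ∸ j) (spot u) → W u ≡ true
        marked u ru rs = trans (cong (_∧ (j ≤ᵇ spot u)) (≤⇒≤ᵇ-true (≤-trans (n≤1+n c) (proj₁ (within⇒bounds ru)))))
                               (≤⇒≤ᵇ-true (proj₁ (within⇒bounds rs)))
        onto : ∀ s → Within j (suc n ∸ j) s → Σ ℕ λ u → Within (suc c) (suc n ∸ suc c) u × spot u ≡ s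
        onto s r = let (j≤s , s≤n) = within⇒bounds r
                       (u , c<u , u≤n , e) = occupied⇒later c s c≤n ([j,n]-occupied s j≤s s≤n)
                   in u , bounds⇒within c<u u≤n , e

      overload : Overload j W
      overload = j≤1+n , W≥j , (begin
        suc (suc n)                         ≡⟨ cong suc (m∸n+n≡m j≤1+n) ⟨
        suc (suc n ∸ j + j)                 ≤⟨ +-monoˡ-≤ j (s≤s W-after-c) ⟩
        suc (countFrom W (suc c)) + j       ≡⟨ cong (λ z → bit z + countFrom W (suc c) + j) W-c ⟨
        bit (W c) + countFrom W (suc c) + j ≡⟨ cong (_+ j) (countFrom-step W c c≤n) ⟨
        countFrom W c + j                   ≤⟨ +-monoˡ-≤ j (countFrom-antitone W k≤c) ⟩
        countFrom W k + j                   ∎)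
        where open ≤-Reasoning

    ¬overload⇒parks : (∀ j W → ¬ Overload j W) → ParksAll
    ¬overload⇒parks none c k≤c c≤n with spot c ≤? n
    ... | yes parked = parked
    ... | no unparked = ⊥-elim (none j W overload)
      where open Unparked c k≤c c≤n (≰⇒> unparked)

-- The rearrangement a^(k)

countList : (ℕ → Bool) → List ℕ → ℕ
countList P xs = sum (map (bit ∘ P) xs)

countList-↭ : ∀ P {xs ys} → xs ↭ ys → countList P xs ≡ countList P ys
countList-↭ P p = sum-↭ (↭.map⁺ (bit ∘ P) p)

!-∷ : ∀ (x : ℕ) xs i → 1 ≤ i → (x ∷ xs) ! suc i ≡ xs ! i
!-∷ x xs (suc i) _ = refl

!-++ʳ : ∀ pre L j → 1 ≤ j → (pre ++ L) ! (length pre + j) ≡ L ! j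
!-++ʳ [] L j _ = refl
!-++ʳ (p ∷ pre) L j 1≤j = trans (!-∷ p (pre ++ L) (length pre + j) (≤-trans 1≤j (m≤n+m j _))) (!-++ʳ pre L j 1≤j)

!-++ˡ : ∀ pre L x → 1 ≤ x → x ≤ length pre → (pre ++ L) ! x ≡ pre ! x
!-++ˡ (p ∷ pre) L (suc zero) _ _ = refl
!-++ˡ (p ∷ pre) L (suc (suc x)) _ (s≤s x≤) = !-++ˡ pre L (suc x) (s≤s z≤n) x≤

countRange-! : ∀ P xs → countRange (λ j → P (xs ! j)) 1 (length xs) ≡ countList P xs
countRange-! P [] = refl
countRange-! P (x ∷ xs) = cong (bit (P x) +_) (begin
  countRange (λ j → P ((x ∷ xs) ! j)) 2 (length xs)   ≡⟨ sumRange-shift (λ j → bit (P ((x ∷ xs) ! j))) 1 1 (length xs) ⟩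
  countRange (λ j → P ((x ∷ xs) ! suc j)) 1 (length xs) ≡⟨ sumRange-cong _ _ 1 (length xs) (λ u r → cong (bit ∘ P) (!-∷ x xs u (proj₁ r))) ⟩
  countRange (λ j → P (xs ! j)) 1 (length xs)         ≡⟨ countRange-! P xs ⟩
  countList P xs                                      ∎)
  where open ≡-Reasoning

reverse-sorted : ∀ xs → Linked _≤_ xs → Linked _≥_ (reverse xs)
reverse-sorted [] _ = []
reverse-sorted (y ∷ ys) l = go [] y ys [-] l
  where
  go : ∀ (acc : List ℕ) y ys → Linked _≥_ (y ∷ acc) → Linked _≤_ (y ∷ ys) → Linked _≥_ (foldl (flip _∷_) (y ∷ acc) ys)
  go acc y [] l₁ l₂ = l₁
  go acc y (z ∷ zs) l₁ (y≤z ∷ l₂) = go (y ∷ acc) z zs (y≤z ∷ l₁) l₂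

!-head-≥ : ∀ x xs → Linked _≥_ (x ∷ xs) → ∀ j → 1 ≤ j → j ≤ length xs → xs ! j ≤ x
!-head-≥ x (y ∷ xs) (y≤x ∷ l) (suc zero) _ _ = y≤x
!-head-≥ x (y ∷ xs) (y≤x ∷ l) (suc (suc j)) _ (s≤s j≤) = ≤-trans (!-head-≥ y xs l (suc j) (s≤s z≤n) j≤) y≤x

!-antitone : ∀ xs → Linked _≥_ xs → ∀ i j → 1 ≤ i → i ≤ j → j ≤ length xs → xs ! j ≤ xs ! i
!-antitone (x ∷ xs) l (suc zero) (suc zero) _ _ _ = ≤-refl
!-antitone (x ∷ xs) l (suc zero) (suc (suc j)) _ _ (s≤s j≤) = !-head-≥ x xs l (suc j) (s≤s z≤n) j≤
!-antitone (x ∷ y ∷ xs) (_ ∷ l) (suc (suc i)) (suc (suc j)) _ (s≤s i≤j) (s≤s j≤) = !-antitone (y ∷ xs) l (suc i) (suc j) (s≤s z≤n) i≤j j≤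

module Rearrangement (n k : ℕ) (a : Vec ℕ n) (k≥1 : 1 ≤ k) (k≤n : k ≤ n) where

  open Tail n

  A : ℕ → ℕ
  A = at a

  b : ℕ → ℕ
  b = aK n k a

  private
    k′ : ℕ
    k′ = k ∸ 1

    pre M L : List ℕ
    pre = take k′ (toList a)
    M = drop k′ (toList a)
    L = sortDesc M

    1+k′≡k : suc k′ ≡ k
    1+k′≡k = m+[n∸m]≡n k≥1

    k′≤n : k′ ≤ n
    k′≤n = ≤-trans (m∸n≤m k 1) k≤n

    length-pre : length pre ≡ k′
    length-pre = trans (length-take k′ (toList a)) (trans (cong (k′ ⊓_) (length-toList a)) (m≤n⇒m⊓n≡m k′≤n))

    length-tail : n ∸ k′ ≡ suc n ∸ k
    length-tail = cong (suc n ∸_) 1+k′≡k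

    length-M : length M ≡ suc n ∸ k
    length-M = trans (length-drop k′ (toList a)) (trans (cong (_∸ k′) (length-toList a)) length-tail)

    L↭M : L ↭ M
    L↭M = ↭-trans (↭-reverse (sort M)) (sort-↭ M)

    length-L : length L ≡ suc n ∸ k
    length-L = trans (↭-length L↭M) length-M

    L-sorted : Linked _≥_ L
    L-sorted = reverse-sorted _ (sort-↗ M)

    A≡ : ∀ x → A x ≡ (pre ++ M) ! x
    A≡ x = cong (λ xs → xs ! x) (sym (take++drop≡id k′ (toList a)))

    b-tail : ∀ j → 1 ≤ j → b (k′ + j) ≡ L ! j
    b-tail j 1≤j = trans (cong (λ z → (pre ++ L) ! (z + j)) (sym length-pre)) (!-++ʳ pre L j 1≤j)

    A-tail : ∀ j → 1 ≤ j → A (k′ + j) ≡ M ! j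
    A-tail j 1≤j = trans (A≡ (k′ + j)) (trans (cong (λ z → (pre ++ M) ! (z + j)) (sym length-pre)) (!-++ʳ pre M j 1≤j))

    countFrom-k : ∀ P (f : ℕ → ℕ) xs → length xs ≡ suc n ∸ k → (∀ j → 1 ≤ j → f (k′ + j) ≡ xs ! j) →
                  countFrom (P ∘ f) k ≡ countList P xs
    countFrom-k P f xs len h = begin
      countRange (P ∘ f) k (suc n ∸ k)                 ≡⟨ cong (λ z → countRange (P ∘ f) z (suc n ∸ k)) (trans (sym 1+k′≡k) (+-comm 1 k′)) ⟩
      countRange (P ∘ f) (k′ + 1) (suc n ∸ k)          ≡⟨ sumRange-shift (bit ∘ P ∘ f) k′ 1 (suc n ∸ k) ⟩
      countRange (λ j → P (f (k′ + j))) 1 (suc n ∸ k)  ≡⟨ sumRange-cong _ _ 1 (suc n ∸ k) (λ u r → cong (bit ∘ P) (h u (proj₁ r))) ⟩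
      countRange (λ j → P (xs ! j)) 1 (suc n ∸ k)      ≡⟨ cong (countRange (λ j → P (xs ! j)) 1) (sym len) ⟩
      countRange (λ j → P (xs ! j)) 1 (length xs)      ≡⟨ countRange-! P xs ⟩
      countList P xs                                   ∎
      where open ≡-Reasoning

  aK-below : ∀ x → 1 ≤ x → x < k → b x ≡ A x
  aK-below x 1≤x x<k = trans (!-++ˡ pre L x 1≤x x≤) (sym (trans (A≡ x) (!-++ˡ pre M x 1≤x x≤)))
    where
    x≤ : x ≤ length pre
    x≤ = ≤-trans (≤-pred (≤-trans x<k (≤-reflexive (sym 1+k′≡k)))) (≤-reflexive (sym length-pre))

  aK-count : ∀ (P : ℕ → Bool) → countFrom (P ∘ b) k ≡ countFrom (P ∘ A) k
  aK-count P = trans (countFrom-k P b L length-L b-tail) (trans (countList-↭ P L↭M) (sym (countFrom-k P A M length-M A-tail)))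

  aK-antitone : ∀ x y → k ≤ x → x ≤ y → y ≤ n → b y ≤ b x
  aK-antitone x y k≤x x≤y y≤n =
    subst₂ _≤_ (trans (sym (b-tail (y ∸ k′) 1≤y′)) (cong b y≡)) (trans (sym (b-tail (x ∸ k′) 1≤x′)) (cong b x≡))
      (!-antitone L L-sorted (x ∸ k′) (y ∸ k′) 1≤x′ (∸-monoˡ-≤ k′ x≤y) y′≤)
    where
    k′<x : k′ < x
    k′<x = ≤-trans (≤-reflexive 1+k′≡k) k≤x
    x≡ : k′ + (x ∸ k′) ≡ x
    x≡ = m+[n∸m]≡n (<⇒≤ k′<x)
    y≡ : k′ + (y ∸ k′) ≡ y
    y≡ = m+[n∸m]≡n (≤-trans (<⇒≤ k′<x) x≤y)
    1≤x′ : 1 ≤ x ∸ k′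
    1≤x′ = m<n⇒0<n∸m k′<x
    1≤y′ : 1 ≤ y ∸ k′
    1≤y′ = ≤-trans 1≤x′ (∸-monoˡ-≤ k′ x≤y)
    y′≤ : y ∸ k′ ≤ length L
    y′≤ = ≤-trans (∸-monoˡ-≤ k′ y≤n) (≤-reflexive (trans length-tail (sym length-L)))

-- The centre

linked->-head : ∀ {y S} → Linked _>_ (y ∷ S) → ∀ z → z ∈ S → z < y
linked->-head {y} {x ∷ S} (y>x ∷ l) z (here refl) = y>x
linked->-head {y} {x ∷ S} (y>x ∷ l) z (there z∈) = <-trans (linked->-head l z z∈) y>x

linked->-∷ : ∀ x xs → Linked _>_ xs → (∀ y → y ∈ xs → y < x) → Linked _>_ (x ∷ xs)
linked->-∷ x [] l h = [-]
linked->-∷ x (y ∷ xs) l h = h y (here refl) ∷ l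

-- x = i_p satisfies b x ≤ p, and p − j counts the elements of S before x, all larger than x.
IndexBound-position : ∀ (b : ℕ → ℕ) j S → Linked _>_ S → IndexBound b j S → ∀ x → x ∈ S → b x ≤ j + countList (x <ᵇ_) S
IndexBound-position b j (y ∷ S) l (by , ib) x (here refl) = ≤-trans by (m≤m+n j _)
IndexBound-position b j (y ∷ S) l (by , ib) x (there x∈) =
  ≤-trans (IndexBound-position b (suc j) S (Linked.tail l) ib x x∈) (≤-reflexive shift)
  where
  shift : suc j + countList (x <ᵇ_) S ≡ j + (bit (x <ᵇ y) + countList (x <ᵇ_) S)
  shift rewrite <⇒<ᵇ-true (linked->-head l x x∈) = sym (+-suc j _)

countList-absent : ∀ (P : ℕ → Bool) S → (∀ y → y ∈ S → P y ≡ false) → countList P S ≡ 0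
countList-absent P [] h = refl
countList-absent P (y ∷ S) h rewrite h y (here refl) = countList-absent P S (λ z z∈ → h z (there z∈))

countList-≡ᵇ-≤1 : ∀ S v → Linked _>_ S → countList (_≡ᵇ v) S ≤ 1
countList-≡ᵇ-≤1 [] v l = z≤n
countList-≡ᵇ-≤1 (y ∷ S) v l with y ≟ v
... | yes refl rewrite ≡ᵇ-refl y =
  s≤s (≤-reflexive (countList-absent (_≡ᵇ y) S (λ z z∈ → ≢⇒≡ᵇ-false (<⇒≢ (linked->-head l z z∈)))))
... | no y≢v rewrite ≢⇒≡ᵇ-false y≢v = countList-≡ᵇ-≤1 S v (Linked.tail l)

countList-≡ᵇ⇒∈ : ∀ v S → 1 ≤ countList (_≡ᵇ v) S → v ∈ S
countList-≡ᵇ⇒∈ v (y ∷ S) p with y ≟ v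
... | yes refl = here refl
... | no y≢v rewrite ≢⇒≡ᵇ-false y≢v = there (countList-≡ᵇ⇒∈ v S p)

countList-+ : ∀ (P Q R : ℕ → Bool) S → (∀ y → bit (P y) ≡ bit (Q y) + bit (R y)) →
              countList P S ≡ countList Q S + countList R S
countList-+ P Q R [] h = refl
countList-+ P Q R (y ∷ S) h rewrite h y | countList-+ P Q R S h =
  interchange (bit (Q y)) (bit (R y)) (countList Q S) (countList R S)

bit-≤ᵇ-split : ∀ v y → bit (v ≤ᵇ y) ≡ bit (suc v ≤ᵇ y) + bit (y ≡ᵇ v)
bit-≤ᵇ-split v y with <-cmp v y
... | tri< v<y _ _ rewrite ≤⇒≤ᵇ-true (<⇒≤ v<y) | ≤⇒≤ᵇ-true v<y | ≢⇒≡ᵇ-false (<⇒≢ v<y ∘ sym) = refl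
... | tri≈ _ refl _ rewrite ≤⇒≤ᵇ-true (≤-refl {v}) | >⇒≤ᵇ-false {suc v} {v} ≤-refl | ≡ᵇ-refl v = refl
... | tri> _ _ y<v rewrite >⇒≤ᵇ-false y<v | >⇒≤ᵇ-false {suc v} {y} (≤-trans y<v (n≤1+n v)) | ≢⇒≡ᵇ-false (<⇒≢ y<v) = refl

countList-≥-below : ∀ k S → (∀ y → y ∈ S → y < k) → countList (k ≤ᵇ_) S ≡ 0
countList-≥-below k S h = countList-absent (k ≤ᵇ_) S (λ y y∈ → >⇒≤ᵇ-false (h y y∈))

countList-≥-bound : ∀ k → 1 ≤ k → ∀ m S → Linked _>_ S → (∀ y → y ∈ S → y ≤ m) → countList (k ≤ᵇ_) S ≤ suc m ∸ k
countList-≥-bound k k≥1 m [] l h = z≤n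
countList-≥-bound k k≥1 m (x ∷ S) l h with k ≤? x
... | no k≰x rewrite >⇒≤ᵇ-false (≰⇒> k≰x) | countList-≥-below k S (λ y y∈ → <-trans (linked->-head l y y∈) (≰⇒> k≰x)) = z≤n
... | yes k≤x rewrite ≤⇒≤ᵇ-true k≤x = begin
  suc (countList (k ≤ᵇ_) S) ≤⟨ s≤s (countList-≥-bound k k≥1 (pred x) S (Linked.tail l) (λ y y∈ → <⇒≤pred (linked->-head l y y∈))) ⟩
  suc (suc (pred x) ∸ k)     ≡⟨ cong (λ z → suc (z ∸ k)) (suc-pred x {{>-nonZero (≤-trans k≥1 k≤x)}}) ⟩
  suc (x ∸ k)                ≡⟨ +-∸-assoc 1 k≤x ⟨
  suc x ∸ k                  ≤⟨ ∸-monoˡ-≤ k (s≤s (h x (here refl))) ⟩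
  suc m ∸ k                  ∎
  where open ≤-Reasoning

-- The p-th element i_p of S satisfies i_p ≤ n + 1 − p, so while i_p ≥ k antitonicity of b on [k, n]
-- gives b (n + 1 − p) ≤ b i_p ≤ p.
IndexBound-top : (b : ℕ → ℕ) (n k : ℕ) → (∀ x y → k ≤ x → x ≤ y → y ≤ n → b y ≤ b x) →
  ∀ j S → 1 ≤ j → Linked _>_ S → IndexBound b j S → (∀ y → y ∈ S → y + j ≤ suc n) →
  ∀ p → j ≤ p → p < j + countList (k ≤ᵇ_) S → b (suc n ∸ p) ≤ p
IndexBound-top b n k antitone j [] 1≤j l ib bound p j≤p p< = ⊥-elim (<⇒≱ p< (≤-trans (≤-reflexive (+-identityʳ j)) j≤p))
IndexBound-top b n k antitone j (x ∷ S) 1≤j l (bx , ib) bound p j≤p p< with k ≤? x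
... | no k≰x rewrite >⇒≤ᵇ-false (≰⇒> k≰x) | countList-≥-below k S (λ y y∈ → <-trans (linked->-head l y y∈) (≰⇒> k≰x)) =
  ⊥-elim (<⇒≱ p< (≤-trans (≤-reflexive (+-identityʳ j)) j≤p))
... | yes k≤x rewrite ≤⇒≤ᵇ-true k≤x with m≤n⇒m<n∨m≡n j≤p
...   | inj₂ refl = ≤-trans (antitone x (suc n ∸ j) k≤x (m+n≤o⇒m≤o∸n x (bound x (here refl))) (∸-monoʳ-≤ (suc n) 1≤j)) bx
...   | inj₁ j<p = IndexBound-top b n k antitone (suc j) S (s≤s z≤n) (Linked.tail l) ib bound′ p j<p (≤-trans p< (≤-reflexive (+-suc j _)))
  where
  bound′ : ∀ y → y ∈ S → y + suc j ≤ suc n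
  bound′ y y∈ = ≤-trans (≤-reflexive (+-suc y j)) (≤-trans (+-monoˡ-≤ j (linked->-head l y y∈)) (bound x (here refl)))

-- Scanning x = n, n − 1, …, 1 and keeping x whenever b x ≤ 1 + (number kept so far) yields the centre.
module Centre (n : ℕ) (b : ℕ → ℕ) where

  open Tail n

  greedyCount : ℕ → ℕ
  greedyCount zero = 0
  greedyCount (suc d) = bit (b (n ∸ d) ≤ᵇ suc (greedyCount d)) + greedyCount d

  Greedy : ℕ → Bool
  Greedy x = (1 ≤ᵇ x) ∧ ((x ≤ᵇ n) ∧ (b x ≤ᵇ suc (greedyCount (n ∸ x))))

  private
    Greedy-inside : ∀ x → 1 ≤ x → x ≤ n → Greedy x ≡ (b x ≤ᵇ suc (greedyCount (n ∸ x)))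
    Greedy-inside x 1≤x x≤n rewrite ≤⇒≤ᵇ-true 1≤x | ≤⇒≤ᵇ-true x≤n = refl

    Greedy-bounds : ∀ x → Greedy x ≡ true → 1 ≤ x × x ≤ n
    Greedy-bounds x e = ≤ᵇ-true⇒≤ (∧-conicalˡ (1 ≤ᵇ x) _ e) , ≤ᵇ-true⇒≤ (∧-conicalˡ (x ≤ᵇ n) _ (∧-conicalʳ (1 ≤ᵇ x) _ e))

    countFrom-Greedy : ∀ d → d ≤ n → countFrom Greedy (suc (n ∸ d)) ≡ greedyCount d
    countFrom-Greedy zero _ = countFrom-beyond Greedy (suc n) ≤-refl
    countFrom-Greedy (suc d) d<n = begin
      countFrom Greedy (suc (n ∸ suc d))                    ≡⟨ cong (countFrom Greedy) (sym (+-∸-assoc 1 d<n)) ⟩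
      countFrom Greedy (n ∸ d)                              ≡⟨ countFrom-step Greedy (n ∸ d) (m∸n≤m n d) ⟩
      bit (Greedy (n ∸ d)) + countFrom Greedy (suc (n ∸ d)) ≡⟨ cong₂ _+_ (cong bit head) (countFrom-Greedy d (<⇒≤ d<n)) ⟩
      bit (b (n ∸ d) ≤ᵇ suc (greedyCount d)) + greedyCount d ∎
      where
      open ≡-Reasoning
      head : Greedy (n ∸ d) ≡ (b (n ∸ d) ≤ᵇ suc (greedyCount d))
      head = trans (Greedy-inside (n ∸ d) (m<n⇒0<n∸m d<n) (m∸n≤m n d)) (cong (λ z → b (n ∸ d) ≤ᵇ suc (greedyCount z)) (m∸[m∸n]≡n (<⇒≤ d<n)))

  Greedy-char : ∀ x → 1 ≤ x → x ≤ n → Greedy x ≡ (b x ≤ᵇ suc (countFrom Greedy (suc x)))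
  Greedy-char x 1≤x x≤n = trans (Greedy-inside x 1≤x x≤n)
    (cong (λ z → b x ≤ᵇ suc z) (sym (trans (cong (λ z → countFrom Greedy (suc z)) (sym (m∸[m∸n]≡n x≤n))) (countFrom-Greedy (n ∸ x) (m∸n≤m n x)))))

  greedy : ℕ → List ℕ
  greedy zero = []
  greedy (suc m) = if Greedy (suc m) then suc m ∷ greedy m else greedy m

  private
    greedy-sound : ∀ m y → y ∈ greedy m → y ≤ m × Greedy y ≡ true
    greedy-sound (suc m) y y∈ with Greedy (suc m) in e
    greedy-sound (suc m) y (here refl) | true = ≤-refl , e
    greedy-sound (suc m) y (there y∈) | true = let (p , q) = greedy-sound m y y∈ in ≤-trans p (n≤1+n m) , q
    greedy-sound (suc m) y y∈ | false = let (p , q) = greedy-sound m y y∈ in ≤-trans p (n≤1+n m) , q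

    greedy-linked : ∀ m → Linked _>_ (greedy m)
    greedy-linked zero = []
    greedy-linked (suc m) with Greedy (suc m)
    ... | true = linked->-∷ (suc m) (greedy m) (greedy-linked m) (λ y y∈ → s≤s (proj₁ (greedy-sound m y y∈)))
    ... | false = greedy-linked m

    greedy-IndexBound : ∀ m → m ≤ n → IndexBound b (suc (countFrom Greedy (suc m))) (greedy m)
    greedy-IndexBound zero _ = tt
    greedy-IndexBound (suc m) m<n with Greedy (suc m) in e
    ... | true = ≤ᵇ-true⇒≤ (trans (sym (Greedy-char (suc m) (s≤s z≤n) m<n)) e) , subst (λ z → IndexBound b (suc z) (greedy m)) step (greedy-IndexBound m (≤-trans (n≤1+n m) m<n))
      where step = trans (countFrom-step Greedy (suc m) m<n) (cong (λ z → bit z + countFrom Greedy (suc (suc m))) e)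
    ... | false = subst (λ z → IndexBound b (suc z) (greedy m)) step (greedy-IndexBound m (≤-trans (n≤1+n m) m<n))
      where step = trans (countFrom-step Greedy (suc m) m<n) (cong (λ z → bit z + countFrom Greedy (suc (suc m))) e)

    greedy-admissible : Admissible n b (greedy n)
    greedy-admissible = greedy-linked n
      , (λ x x∈ → let (p , q) = greedy-sound n x x∈ in proj₁ (Greedy-bounds x q) , p)
      , subst (λ z → IndexBound b (suc z) (greedy n)) (countFrom-beyond Greedy (suc n) ≤-refl) (greedy-IndexBound n ≤-refl)

    -- An admissible list starting at index j is dominated position by position by the greedy one.
    HeadBound : ℕ → List ℕ → Set
    HeadBound j [] = ⊤
    HeadBound j (h ∷ _) = j ≤ suc (countFrom Greedy (suc h))

    HeadBound-next : ∀ h j T → Linked _>_ (h ∷ T) → Greedy h ≡ true → h ≤ n → j ≤ suc (countFrom Greedy (suc h)) → HeadBound (suc j) T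
    HeadBound-next h j [] l Gh h≤n hb = tt
    HeadBound-next h j (h′ ∷ T) (h>h′ ∷ _) Gh h≤n hb = begin
      suc j                                 ≤⟨ s≤s hb ⟩
      suc (suc (countFrom Greedy (suc h)))  ≡⟨ cong suc (trans (countFrom-step Greedy h h≤n) (cong (λ z → bit z + countFrom Greedy (suc h)) Gh)) ⟨
      suc (countFrom Greedy h)              ≤⟨ s≤s (countFrom-antitone Greedy h>h′) ⟩
      suc (countFrom Greedy (suc h′))       ∎
      where open ≤-Reasoning

    admissible⇒Greedy : ∀ j T → Linked _>_ T → IndexBound b j T → (∀ x → x ∈ T → InRange n x) → HeadBound j T →
                        ∀ x → x ∈ T → Greedy x ≡ true
    admissible⇒Greedy j (h ∷ T) l (bh , ib) range hb x x∈ = go x∈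
      where
      Gh : Greedy h ≡ true
      Gh = trans (Greedy-char h (proj₁ (range h (here refl))) (proj₂ (range h (here refl)))) (≤⇒≤ᵇ-true (≤-trans bh hb))
      go : x ∈ (h ∷ T) → Greedy x ≡ true
      go (here refl) = Gh
      go (there x∈T) = admissible⇒Greedy (suc j) T (Linked.tail l) ib (λ y y∈ → range y (there y∈))
                         (HeadBound-next h j T l Gh (proj₂ (range h (here refl))) hb) x x∈T

  greedy-complete : ∀ m y → y ≤ m → Greedy y ≡ true → y ∈ greedy m
  greedy-complete zero y y≤0 e = ⊥-elim (<⇒≱ (proj₁ (Greedy-bounds y e)) y≤0)
  greedy-complete (suc m) y y≤ e with m≤n⇒m<n∨m≡n y≤
  ... | inj₂ refl rewrite e = here refl
  ... | inj₁ y<1+m with Greedy (suc m)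
  ...   | true = there (greedy-complete m y (≤-pred y<1+m) e)
  ...   | false = greedy-complete m y (≤-pred y<1+m) e

  greedy-isCentre : IsCentre n b (greedy n)
  greedy-isCentre = greedy-admissible , λ T (l , range , ib) x x∈ →
    greedy-complete n x (proj₂ (range x x∈)) (admissible⇒Greedy 1 T l ib range (start T) x x∈)
    where
    start : ∀ T → HeadBound 1 T
    start [] = tt
    start (h ∷ T) = s≤s z≤n

-- The three conditions

All-at : ∀ {P : ℕ → Set} {m} (xs : Vec ℕ m) → All P xs → ∀ v → 1 ≤ v → v ≤ m → P (at xs v)
All-at (x ∷ xs) (px ∷ pxs) (suc zero) _ _ = px
All-at (x ∷ y ∷ xs) (px ∷ pxs) (suc (suc v)) _ (s≤s v≤) = All-at (y ∷ xs) pxs (suc v) (s≤s z≤n) v≤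

∈?-true⇒∈ : ∀ v xs → does (v ∈? xs) ≡ true → v ∈ xs
∈?-true⇒∈ v xs e with v ∈? xs
... | yes v∈ = v∈

∈⇒∈?-true : ∀ v xs → v ∈ xs → does (v ∈? xs) ≡ true
∈⇒∈?-true v xs v∈ with v ∈? xs
... | yes _ = refl
... | no v∉ = ⊥-elim (v∉ v∈)

module Characterisation (n k : ℕ) (k≥2 : 2 ≤ k) (k≤n : k ≤ n) (a : Vec ℕ n) (range : All (InRange n) a) where

  open Graph n k k≥2 k≤n
  open Parking n a using (spot; pp≡spot)

  k≥1 : 1 ≤ k
  k≥1 = ≤-trans (s≤s z≤n) k≥2

  A : ℕ → ℕ
  A = at a

  A≥1 : ∀ v → 1 ≤ v → v ≤ n → 1 ≤ A v
  A≥1 v 1≤v v≤n = proj₁ (All-at a range v 1≤v v≤n)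

  A≤n : ∀ v → 1 ≤ v → v ≤ n → A v ≤ n
  A≤n v 1≤v v≤n = proj₂ (All-at a range v 1≤v v≤n)

  open Outcome A A≥1
  open Parking.Hall n a k k≥1 A≥1 A≤n
  open Rearrangement n k a k≥1 k≤n using (b; aK-below; aK-antitone; aK-count)
  open Centre n b using (Greedy; Greedy-char; greedy; greedy-isCentre; greedy-complete)

  B : ℕ → Bool
  B = burnt final

  ∈burntList⇔B : ∀ v → v ∈ burntList n k a ⇔ B v ≡ true
  ∈burntList⇔B v = mk⇔ (∈⇒∈?-true v (burntList n k a)) (∈?-true⇒∈ v (burntList n k a))

  ∈burntList⇒≤n : ∀ v → v ∈ burntList n k a → v ≤ n
  ∈burntList⇒≤n v v∈ = burnt-≤n v (Equivalence.to (∈burntList⇔B v) v∈)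

  ParksFrom⇔ParksAll : ParksFrom n k a ⇔ ParksAll
  ParksFrom⇔ParksAll = mk⇔ (λ pf c k≤c c≤n → subst (_≤ n) (pp≡spot c (≤-trans k≥1 k≤c) c≤n) (pf c k≤c c≤n))
                           (λ pa c k≤c c≤n → subst (_≤ n) (sym (pp≡spot c (≤-trans k≥1 k≤c) c≤n)) (pa c k≤c c≤n))

  k+[1+n∸k]≡1+n : k + (suc n ∸ k) ≡ suc n
  k+[1+n∸k]≡1+n = m+[n∸m]≡n (≤-trans k≤n (n≤1+n n))

  Full : Set
  Full = ∀ v → v ≤ n → B v ≡ true

  module _ (j : ℕ) (W : ℕ → Bool) (overload : Overload j W) where

    private
      j≤1+n = proj₁ overload
      W≥j = proj₁ (proj₂ overload)
      many = proj₂ (proj₂ overload)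

    outsideW : ℕ → Bool
    outsideW u = not ((k ≤ᵇ u) ∧ ((u ≤ᵇ n) ∧ W u))

    outsideW-0 : outsideW 0 ≡ true
    outsideW-0 rewrite >⇒≤ᵇ-false {k} {0} k≥1 = refl

    -- A vertex of W receives k + |outsideW ∩ [k, n]| < j arcs from outsideW.
    outsideW-stable : Stable A outsideW
    outsideW-stable v _ v≤n v∉C = begin-strict
      indeg C v                              ≡⟨ indeg-large C v outsideW-0 k≤v v≤n v∉C ⟩
      (if C 1 then k else 1) + countFrom C k ≡⟨ cong (λ z → (if z then k else 1) + countFrom C k) C1 ⟩
      k + countFrom C k                      <⟨ few-arcs ⟩
      j                                      ≤⟨ W≥j v k≤v v≤n Wv ⟩
      A v                                    ∎
      where
      open ≤-Reasoning
      C = outsideW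
      C1 : C 1 ≡ true
      C1 rewrite >⇒≤ᵇ-false {k} {1} k≥2 = refl
      inW : ((k ≤ᵇ v) ∧ ((v ≤ᵇ n) ∧ W v)) ≡ true
      inW = not-injective v∉C
      k≤v = ≤ᵇ-true⇒≤ (∧-conicalˡ _ _ inW)
      Wv = ∧-conicalʳ (v ≤ᵇ n) _ (∧-conicalʳ (k ≤ᵇ v) _ inW)
      split : countFrom W k + countFrom C k ≡ suc n ∸ k
      split = trans (cong (countFrom W k +_) (countFrom-cong C (not ∘ W) k
                (λ u k≤u u≤n → cong not (trans (cong (_∧ ((u ≤ᵇ n) ∧ W u)) (≤⇒≤ᵇ-true k≤u)) (cong (_∧ W u) (≤⇒≤ᵇ-true u≤n))))))
              (countFrom-complement W k)
      few-arcs : suc (k + countFrom C k) ≤ j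
      few-arcs = +-cancelʳ-≤ (countFrom W k) _ j (begin
        suc (k + countFrom C k) + countFrom W k   ≡⟨ cong suc (+-assoc k _ _) ⟩
        suc (k + (countFrom C k + countFrom W k)) ≡⟨ cong (λ z → suc (k + z)) (trans (+-comm _ (countFrom W k)) split) ⟩
        suc (k + (suc n ∸ k))                     ≡⟨ cong suc k+[1+n∸k]≡1+n ⟩
        suc (suc n)                               ≤⟨ many ⟩
        countFrom W k + j                         ≡⟨ +-comm (countFrom W k) j ⟩
        j + countFrom W k                         ∎)

    overload⇒unburnt : Σ ℕ λ v → v ≤ n × B v ≡ false
    overload⇒unburnt = v , v≤n , ¬T⇒≡false λ Bv → true≢false (trans (sym (burnt-least outsideW outsideW-0 outsideW-stable v (T⇒≡true Bv))) v∉C)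
      where
      W-nonempty : 1 ≤ countFrom W k
      W-nonempty = ≮⇒≥ (λ empty → <⇒≱ (≤-trans many (+-monoˡ-≤ j (≤-pred empty))) j≤1+n)
      witness = countFrom-witness W k W-nonempty
      v = proj₁ witness
      v≤n = proj₁ (proj₂ (proj₂ witness))
      v∉C : outsideW v ≡ false
      v∉C rewrite ≤⇒≤ᵇ-true (proj₁ (proj₂ witness)) | ≤⇒≤ᵇ-true v≤n | proj₂ (proj₂ (proj₂ witness)) = refl

  full⇒parks : Full → ParksAll
  full⇒parks full = ¬overload⇒parks λ j W overload →
    let (v , v≤n , v∉B) = overload⇒unburnt j W overload in true≢false (trans (sym (full v v≤n)) v∉B)

  indeg-large-1-burnt : B 1 ≡ true → ∀ u → k ≤ u → u ≤ n → B u ≡ false → indeg B u ≡ k + countFrom B k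
  indeg-large-1-burnt b1 u k≤u u≤n u∉B =
    trans (indeg-large B u burnt-0 k≤u u≤n u∉B) (cong (λ z → (if z then k else 1) + countFrom B k) b1)

  #unburnt : ℕ
  #unburnt = countFrom (not ∘ B) k

  threshold : ℕ
  threshold = suc (suc n) ∸ #unburnt

  #burnt+#unburnt : countFrom B k + #unburnt ≡ suc n ∸ k
  #burnt+#unburnt = countFrom-complement B k

  threshold+#unburnt : threshold + #unburnt ≡ suc (suc n)
  threshold+#unburnt = m∸n+n≡m (≤-trans (≤-trans (m≤n+m #unburnt (countFrom B k))
    (≤-trans (≤-reflexive #burnt+#unburnt) (m∸n≤m (suc n) k))) (n≤1+n _))

  -- An unburnt car u ≥ k receives k + |B ∩ [k, n]| = n + 1 − #unburnt arcs, hence prefers a spot ≥ threshold.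
  unburnt⇒threshold≤A : B 1 ≡ true → ∀ u → k ≤ u → u ≤ n → B u ≡ false → threshold ≤ A u
  unburnt⇒threshold≤A b1 u k≤u u≤n u∉B = +-cancelʳ-≤ #unburnt threshold (A u) (begin
    threshold + #unburnt               ≡⟨ threshold+#unburnt ⟩
    suc (suc n)                        ≡⟨ cong suc k+[1+n∸k]≡1+n ⟨
    suc (k + (suc n ∸ k))              ≡⟨ cong (λ z → suc (k + z)) #burnt+#unburnt ⟨
    suc (k + (countFrom B k + #unburnt)) ≡⟨ cong suc (+-assoc k _ _) ⟨
    suc (k + countFrom B k) + #unburnt ≡⟨ cong (λ z → suc z + #unburnt) (indeg-large-1-burnt b1 u k≤u u≤n u∉B) ⟨
    suc (indeg B u) + #unburnt         ≤⟨ +-monoˡ-≤ #unburnt (burnt-stable u (≤-trans k≥1 k≤u) u≤n u∉B) ⟩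
    A u + #unburnt                     ∎)
    where open ≤-Reasoning

  large-burnt : ParksAll → B 1 ≡ true → ∀ v → k ≤ v → v ≤ n → B v ≡ true
  large-burnt parks b1 v k≤v v≤n with B v in v∈B
  ... | true = refl
  ... | false = ⊥-elim (parks⇒¬overload parks threshold (not ∘ B)
      (∸-monoʳ-≤ (suc (suc n)) some-unburnt , (λ u k≤u u≤n e → unburnt⇒threshold≤A b1 u k≤u u≤n (not-injective e)) ,
       ≤-reflexive (sym (trans (+-comm #unburnt threshold) threshold+#unburnt))))
    where
    some-unburnt : 1 ≤ #unburnt
    some-unburnt = countFrom-pos (not ∘ B) k v k≤v v≤n (cong not v∈B)

  BurntFrom : ℕ → Set
  BurntFrom v = ∀ u → v ≤ u → u ≤ n → B u ≡ true

  -- With [v + 1, n] burnt, an unburnt v < k would receive v + (n − v) = n ≥ A v arcs.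
  small-burnt : B 1 ≡ true → ∀ v → 2 ≤ v → v < k → BurntFrom (suc v) → BurntFrom v
  small-burnt b1 v 2≤v v<k above u v≤u u≤n with m≤n⇒m<n∨m≡n v≤u
  ... | inj₁ v<u = above u v<u u≤n
  ... | inj₂ refl with B v in v∈B
  ...   | true = refl
  ...   | false = ⊥-elim (<⇒≱ (burnt-stable v (≤-trans (s≤s z≤n) 2≤v) v≤n v∈B) (begin
    A v                                     ≤⟨ A≤n v (≤-trans (s≤s z≤n) 2≤v) v≤n ⟩
    n                                       ≡⟨ m+[n∸m]≡n v≤n ⟨
    v + (n ∸ v)                             ≡⟨ cong (λ z → (if z then v else 1) + z′) b1 ⟨
    (if B 1 then v else 1) + z′             ≡⟨ cong ((if B 1 then v else 1) +_) (countFrom-all B (suc v) above) ⟨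
    (if B 1 then v else 1) + countFrom B (suc v) ≡⟨ indeg-small B v burnt-0 2≤v v<k ⟨
    indeg B v                               ∎))
    where
    open ≤-Reasoning
    v≤n = ≤-trans (<⇒≤ v<k) k≤n
    z′ = n ∸ v

  parks∧1-burnt⇒full : ParksAll → B 1 ≡ true → Full
  parks∧1-burnt⇒full parks b1 zero _ = burnt-0
  parks∧1-burnt⇒full parks b1 (suc zero) _ = b1
  parks∧1-burnt⇒full parks b1 (suc (suc w)) v≤n = burnt-from (k ∸ 2) 2 (m+[n∸m]≡n k≥2) ≤-refl (suc (suc w)) (s≤s (s≤s z≤n)) v≤n
    where
    burnt-from : ∀ d v → v + d ≡ k → 2 ≤ v → BurntFrom v
    burnt-from zero v v+0≡k _ = subst BurntFrom (trans (sym v+0≡k) (+-identityʳ v)) (large-burnt parks b1)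
    burnt-from (suc d) v v+d≡k 2≤v = small-burnt b1 v 2≤v v<k (burnt-from d (suc v) (trans (sym (+-suc v d)) v+d≡k) (≤-trans 2≤v (n≤1+n v)))
      where
      v<k : v < k
      v<k = ≤-trans (s≤s (m≤m+n v d)) (≤-reflexive (trans (sym (+-suc v d)) v+d≡k))

  module _ (S : List ℕ) (admissible : Admissible n b S) (1∉B : B 1 ≡ false) where

    private
      linked = proj₁ admissible
      S-range = proj₁ (proj₂ admissible)
      S-bound = proj₂ (proj₂ admissible)

    stable-1 : suc (countFrom B 2) < A 1
    stable-1 = subst (_< A 1) (indeg-1 B burnt-0) (burnt-stable 1 ≤-refl (≤-trans k≥1 k≤n) 1∉B)

    stable-small : ∀ v → 2 ≤ v → v < k → B v ≡ false → suc (countFrom B (suc v)) < A v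
    stable-small v 2≤v v<k v∉B = subst (_< A v) (trans (indeg-small B v burnt-0 2≤v v<k) (cong (λ z → (if z then v else 1) + countFrom B (suc v)) 1∉B))
      (burnt-stable v (≤-trans (s≤s z≤n) 2≤v) (≤-trans (<⇒≤ v<k) k≤n) v∉B)

    stable-large : ∀ u → k ≤ u → u ≤ n → B u ≡ false → suc (countFrom B k) < A u
    stable-large u k≤u u≤n u∉B = subst (_< A u) (trans (indeg-large B u burnt-0 k≤u u≤n u∉B) (cong (λ z → (if z then k else 1) + countFrom B k) 1∉B))
      (burnt-stable u (≤-trans k≥1 k≤u) u≤n u∉B)

    -- More than t large members of S force b ≤ t + 1 on the last t + 1 positions.
    many-small-at-top : ∀ t → t < countList (k ≤ᵇ_) S → suc t ≤ countFrom (λ x → b x ≤ᵇ suc t) k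
    many-small-at-top t t<r = begin
      suc t                              ≡⟨ 1+n∸lo ⟨
      suc n ∸ lo                         ≡⟨ countFrom-all (λ x → b x ≤ᵇ suc t) lo small-at-top ⟨
      countFrom (λ x → b x ≤ᵇ suc t) lo  ≤⟨ countFrom-antitone (λ x → b x ≤ᵇ suc t) k≤lo ⟩
      countFrom (λ x → b x ≤ᵇ suc t) k   ∎
      where
      open ≤-Reasoning
      t<N : t < suc n ∸ k
      t<N = ≤-trans t<r (countList-≥-bound k k≥1 n S linked (λ y y∈ → proj₂ (S-range y y∈)))
      t≤n : t ≤ n
      t≤n = ≤-trans (n≤1+n t) (≤-trans t<N (∸-monoʳ-≤ (suc n) k≥1))
      lo = n ∸ t
      1+n∸lo : suc n ∸ lo ≡ suc t
      1+n∸lo = trans (+-∸-assoc 1 (m∸n≤m n t)) (cong suc (m∸[m∸n]≡n t≤n))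
      k≤lo : k ≤ lo
      k≤lo = m+n≤o⇒m≤o∸n k (≤-pred (begin
        suc (k + t)       ≡⟨ cong suc (+-comm k t) ⟩
        suc t + k         ≤⟨ +-monoˡ-≤ k t<N ⟩
        (suc n ∸ k) + k   ≡⟨ m∸n+n≡m (≤-trans k≤n (n≤1+n n)) ⟩
        suc n             ∎))
      top : ∀ p → 1 ≤ p → p < 1 + countList (k ≤ᵇ_) S → b (suc n ∸ p) ≤ p
      top = IndexBound-top b n k aK-antitone 1 S ≤-refl linked S-bound (λ y y∈ → ≤-trans (≤-reflexive (+-comm y 1)) (s≤s (proj₂ (S-range y y∈))))
      small-at-top : ∀ x → lo ≤ x → x ≤ n → (b x ≤ᵇ suc t) ≡ true
      small-at-top x lo≤x x≤n = ≤⇒≤ᵇ-true (subst (λ z → b z ≤ suc t) (m∸[m∸n]≡n (≤-trans x≤n (n≤1+n n)))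
                                  (≤-trans (top p (m<n⇒0<n∸m (s≤s x≤n)) (s≤s (≤-trans p≤1+t t<r))) p≤1+t))
        where
        p = suc n ∸ x
        p≤1+t : p ≤ suc t
        p≤1+t = ≤-trans (∸-monoʳ-≤ (suc n) lo≤x) (≤-reflexive 1+n∸lo)

    cheap-large-burnt : countFrom (λ x → A x ≤ᵇ suc (countFrom B k)) k ≤ countFrom B k
    cheap-large-burnt = countFrom-mono (λ x → A x ≤ᵇ suc (countFrom B k)) B k burns
      where
      burns : ∀ u → k ≤ u → u ≤ n → (A u ≤ᵇ suc (countFrom B k)) ≡ true → B u ≡ true
      burns u k≤u u≤n e with B u in u∈B
      ... | true = refl
      ... | false = ⊥-elim (<⇒≱ (stable-large u k≤u u≤n u∈B) (≤ᵇ-true⇒≤ e))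

    large-members≤burnt : countList (k ≤ᵇ_) S ≤ countFrom B k
    large-members≤burnt = ≮⇒≥ λ t<r → <-irrefl refl (begin-strict
      countFrom B k                                       <⟨ many-small-at-top (countFrom B k) t<r ⟩
      countFrom (λ x → b x ≤ᵇ suc (countFrom B k)) k      ≡⟨ aK-count (_≤ᵇ suc (countFrom B k)) ⟩
      countFrom (λ x → A x ≤ᵇ suc (countFrom B k)) k      ≤⟨ cheap-large-burnt ⟩
      countFrom B k                                       ∎)
      where open ≤-Reasoning

    -- A member v < k of S has A v = b v ≤ 1 + |S ∩ (v, n]|, so stable-small makes it burn.
    member-step : ∀ v → 2 ≤ v → v < k → countList (suc v ≤ᵇ_) S ≤ countFrom B (suc v) → countList (v ≤ᵇ_) S ≤ countFrom B v
    member-step v 2≤v v<k IH with countList (_≡ᵇ v) S in v∈?S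
    ... | zero = begin
      countList (v ≤ᵇ_) S                           ≡⟨ split ⟩
      countList (suc v ≤ᵇ_) S + countList (_≡ᵇ v) S ≡⟨ cong (countList (suc v ≤ᵇ_) S +_) v∈?S ⟩
      countList (suc v ≤ᵇ_) S + 0                   ≡⟨ +-identityʳ _ ⟩
      countList (suc v ≤ᵇ_) S                       ≤⟨ IH ⟩
      countFrom B (suc v)                           ≤⟨ countFrom-suc-≤ B v ⟩
      countFrom B v                                 ∎
      where
      open ≤-Reasoning
      split = countList-+ (v ≤ᵇ_) (suc v ≤ᵇ_) (_≡ᵇ v) S (bit-≤ᵇ-split v)
    ... | suc _ = begin
      countList (v ≤ᵇ_) S                           ≡⟨ split ⟩
      countList (suc v ≤ᵇ_) S + countList (_≡ᵇ v) S ≤⟨ +-mono-≤ IH (countList-≡ᵇ-≤1 S v linked) ⟩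
      countFrom B (suc v) + 1                       ≡⟨ +-comm _ 1 ⟩
      bit true + countFrom B (suc v)                ≡⟨ cong (λ z → bit z + countFrom B (suc v)) v∈B ⟨
      bit (B v) + countFrom B (suc v)               ≡⟨ countFrom-step B v (≤-trans (<⇒≤ v<k) k≤n) ⟨
      countFrom B v                                 ∎
      where
      open ≤-Reasoning
      split = countList-+ (v ≤ᵇ_) (suc v ≤ᵇ_) (_≡ᵇ v) S (bit-≤ᵇ-split v)
      v∈S : v ∈ S
      v∈S = countList-≡ᵇ⇒∈ v S (≤-trans (s≤s z≤n) (≤-reflexive (sym v∈?S)))
      A≤ : A v ≤ suc (countFrom B (suc v))
      A≤ = ≤-trans (≤-reflexive (sym (aK-below v (≤-trans (s≤s z≤n) 2≤v) v<k))) (≤-trans (IndexBound-position b 1 S linked S-bound v v∈S) (s≤s IH))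
      v∈B : B v ≡ true
      v∈B with B v in e
      ... | true = refl
      ... | false = ⊥-elim (<⇒≱ (stable-small v 2≤v v<k e) A≤)

    members≤burnt : ∀ d v → v + d ≡ k → 2 ≤ v → countList (v ≤ᵇ_) S ≤ countFrom B v
    members≤burnt zero v v+0≡k _ = subst (λ z → countList (z ≤ᵇ_) S ≤ countFrom B z) (trans (sym v+0≡k) (+-identityʳ v)) large-members≤burnt
    members≤burnt (suc d) v v+d≡k 2≤v = member-step v 2≤v v<k (members≤burnt d (suc v) (trans (sym (+-suc v d)) v+d≡k) (≤-trans 2≤v (n≤1+n v)))
      where
      v<k : v < k
      v<k = ≤-trans (s≤s (m≤m+n v d)) (≤-reflexive (trans (sym (+-suc v d)) v+d≡k))

    1∉S : ¬ 1 ∈ S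
    1∉S 1∈S = <⇒≱ stable-1 (begin
      A 1                               ≡⟨ aK-below 1 ≤-refl k≥2 ⟨
      b 1                               ≤⟨ IndexBound-position b 1 S linked S-bound 1 1∈S ⟩
      suc (countList (2 ≤ᵇ_) S)         ≤⟨ s≤s (members≤burnt (k ∸ 2) 2 (m+[n∸m]≡n k≥2) ≤-refl) ⟩
      suc (countFrom B 2)               ∎)
      where open ≤-Reasoning

  admissible∋1⇒1-burnt : ∀ S → Admissible n b S → 1 ∈ S → B 1 ≡ true
  admissible∋1⇒1-burnt S admissible 1∈S with B 1 in 1∈B
  ... | true = refl
  ... | false = ⊥-elim (1∉S S admissible 1∈B 1∈S)

  Greedy-false : ∀ x → 1 ≤ x → x ≤ n → Greedy x ≡ false → suc (suc (countFrom Greedy (suc x))) ≤ b x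
  Greedy-false x 1≤x x≤n e = ≤ᵇ-false⇒> (trans (sym (Greedy-char x 1≤x x≤n)) e)

  -- If the greedy list misses some x₀ ∈ [k, n], take the last one and q := |(x₀, n]|; as b is
  -- antitone on [k, n] and b x₀ > q + 1, at most q cars of [k, n] have b ≤ q + 1, hence A ≤ q + 1.
  cut : Σ ℕ λ q → countFrom (λ x → A x ≤ᵇ suc q) k ≤ q × q ≤ countFrom Greedy k
  cut with last-failure Greedy n (suc n ∸ k) k (m∸n+n≡m (≤-trans k≤n (n≤1+n n)))
  ... | inj₁ all = suc n ∸ k , countFrom-≤ (λ x → A x ≤ᵇ suc (suc n ∸ k)) k , ≤-reflexive (sym (countFrom-all Greedy k all))
  ... | inj₂ (x₀ , k≤x₀ , x₀≤n , x₀∉G , above) = q , few , ≤-trans (≤-reflexive (sym #above)) (countFrom-antitone Greedy (≤-trans k≤x₀ (n≤1+n x₀)))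
    where
    q = n ∸ x₀
    #above : countFrom Greedy (suc x₀) ≡ q
    #above = countFrom-all Greedy (suc x₀) above
    b-x₀ : suc (suc q) ≤ b x₀
    b-x₀ = subst (λ z → suc (suc z) ≤ b x₀) #above (Greedy-false x₀ (≤-trans k≥1 k≤x₀) x₀≤n x₀∉G)
    few : countFrom (λ x → A x ≤ᵇ suc q) k ≤ q
    few = begin
      countFrom (λ x → A x ≤ᵇ suc q) k        ≡⟨ aK-count (_≤ᵇ suc q) ⟨
      countFrom (λ x → b x ≤ᵇ suc q) k        ≡⟨ countFrom-skip (λ x → b x ≤ᵇ suc q) (suc x₀) (≤-trans k≤x₀ (n≤1+n x₀))
                                                  (λ x k≤x x≤x₀ → >⇒≤ᵇ-false (≤-trans b-x₀ (aK-antitone x x₀ k≤x (≤-pred x≤x₀) x₀≤n))) ⟩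
      countFrom (λ x → b x ≤ᵇ suc q) (suc x₀) ≤⟨ countFrom-≤ (λ x → b x ≤ᵇ suc q) (suc x₀) ⟩
      q                                       ∎
      where open ≤-Reasoning

  module _ (1∉Greedy : Greedy 1 ≡ false) where

    private
      q = proj₁ cut

    -- Burning cannot leave C := {0} ∪ (Greedy ∩ [2, k)) ∪ {u ∈ [k, n] : A u ≤ q + 1}.
    C : ℕ → Bool
    C u = (u ≡ᵇ 0) ∨ ((((2 ≤ᵇ u) ∧ (u <ᵇ k)) ∧ Greedy u) ∨ (((k ≤ᵇ u) ∧ (u ≤ᵇ n)) ∧ (A u ≤ᵇ suc q)))

    C-1 : C 1 ≡ false
    C-1 rewrite >⇒≤ᵇ-false {k} {1} k≥2 = refl

    C-small : ∀ u → 2 ≤ u → u < k → C u ≡ Greedy u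
    C-small (suc (suc w)) (s≤s (s≤s z≤n)) u<k rewrite <⇒<ᵇ-true u<k | >⇒≤ᵇ-false u<k = ∨-identityʳ (Greedy (suc (suc w)))

    C-large : ∀ u → k ≤ u → u ≤ n → C u ≡ (A u ≤ᵇ suc q)
    C-large u k≤u u≤n rewrite ≤⇒≤ᵇ-true k≤u | ≤⇒≤ᵇ-true u≤n | ≮⇒<ᵇ-false (≤⇒≯ k≤u)
                            | ≢⇒≡ᵇ-false {u} {0} (<⇒≢ (≤-trans k≥1 k≤u) ∘ sym) | ∧-zeroʳ (2 ≤ᵇ u) = refl

    countFrom-C-k : countFrom C k ≤ q
    countFrom-C-k = ≤-trans (≤-reflexive (countFrom-cong C (λ u → A u ≤ᵇ suc q) k C-large)) (proj₁ (proj₂ cut))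

    countFrom-C≤Greedy : ∀ lo → 2 ≤ lo → lo ≤ k → countFrom C lo ≤ countFrom Greedy lo
    countFrom-C≤Greedy lo 2≤lo lo≤k = countFrom-≤-below C Greedy k lo≤k (λ u lo≤u u<k → C-small u (≤-trans 2≤lo lo≤u) u<k)
                                        (≤-trans countFrom-C-k (proj₂ (proj₂ cut)))

    C-stable : Stable A C
    C-stable (suc zero) _ 1≤n _ = begin-strict
      indeg C 1                ≡⟨ indeg-1 C refl ⟩
      suc (countFrom C 2)      ≤⟨ s≤s (countFrom-C≤Greedy 2 ≤-refl k≥2) ⟩
      suc (countFrom Greedy 2) <⟨ Greedy-false 1 ≤-refl 1≤n 1∉Greedy ⟩
      b 1                      ≡⟨ aK-below 1 ≤-refl k≥2 ⟩
      A 1                      ∎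
      where open ≤-Reasoning
    C-stable v@(suc (suc w)) _ v≤n v∉C with k ≤? v
    ... | yes k≤v = begin-strict
      indeg C v                              ≡⟨ indeg-large C v refl k≤v v≤n v∉C ⟩
      (if C 1 then k else 1) + countFrom C k ≡⟨ cong (λ z → (if z then k else 1) + countFrom C k) C-1 ⟩
      suc (countFrom C k)                    ≤⟨ s≤s countFrom-C-k ⟩
      suc q                                  <⟨ ≤ᵇ-false⇒> (trans (sym (C-large v k≤v v≤n)) v∉C) ⟩
      A v                                    ∎
      where open ≤-Reasoning
    ... | no k≰v = begin-strict
      indeg C v                                    ≡⟨ indeg-small C v refl (s≤s (s≤s z≤n)) v<k ⟩
      (if C 1 then v else 1) + countFrom C (suc v) ≡⟨ cong (λ z → (if z then v else 1) + countFrom C (suc v)) C-1 ⟩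
      suc (countFrom C (suc v))                    ≤⟨ s≤s (countFrom-C≤Greedy (suc v) (≤-trans (s≤s (s≤s z≤n)) (n≤1+n v)) v<k) ⟩
      suc (countFrom Greedy (suc v))               <⟨ Greedy-false v (s≤s z≤n) v≤n (trans (sym (C-small v (s≤s (s≤s z≤n)) v<k)) v∉C) ⟩
      b v                                          ≡⟨ aK-below v (s≤s z≤n) v<k ⟩
      A v                                          ∎
      where
      open ≤-Reasoning
      v<k = ≰⇒> k≰v

    1-unburnt : B 1 ≡ false
    1-unburnt with B 1 in 1∈B
    ... | false = refl
    ... | true = ⊥-elim (true≢false (trans (sym (burnt-least C refl C-stable 1 1∈B)) C-1))

  1-burnt⇒1∈centre : B 1 ≡ true → InCentre n b 1
  1-burnt⇒1∈centre 1∈B with Greedy 1 in 1∈G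
  ... | true = greedy n , greedy-isCentre , greedy-complete n 1 (≤-trans k≥1 k≤n) 1∈G
  ... | false = ⊥-elim (true≢false (trans (sym 1∈B) (1-unburnt 1∈G)))

lemma5p2 : (n k : ℕ) → 3 ≤ n → 2 ≤ k → k ≤ n →
    (a : Vec ℕ n) → All (InRange n) a →
    ((ParksFrom n k a × 1 ∈ burntList n k a) ⇔ KPartialPF n k a)
    × (KPartialPF n k a ⇔ (∀ v → (v ∈ burntList n k a) ⇔ (v ≤ n)))
lemma5p2 n k n≥3 k≥2 k≤n a range = mk⇔ 1⇒2 2⇒1 , mk⇔ 2⇒3 3⇒2
  where
  open Characterisation n k k≥2 k≤n a range
  open Equivalence

  1⇒2 : ParksFrom n k a × 1 ∈ burntList n k a → KPartialPF n k a
  1⇒2 (parks , 1∈) = parks , 1-burnt⇒1∈centre (to (∈burntList⇔B 1) 1∈)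

  2⇒1 : KPartialPF n k a → ParksFrom n k a × 1 ∈ burntList n k a
  2⇒1 (parks , S , (admissible , _) , 1∈S) = parks , from (∈burntList⇔B 1) (admissible∋1⇒1-burnt S admissible 1∈S)

  2⇒3 : KPartialPF n k a → ∀ v → (v ∈ burntList n k a) ⇔ (v ≤ n)
  2⇒3 kpf v = let (parks , 1∈) = 2⇒1 kpf in mk⇔
    (∈burntList⇒≤n v)
    (λ v≤n → from (∈burntList⇔B v) (parks∧1-burnt⇒full (to ParksFrom⇔ParksAll parks) (to (∈burntList⇔B 1) 1∈) v v≤n))

  3⇒2 : (∀ v → (v ∈ burntList n k a) ⇔ (v ≤ n)) → KPartialPF n k a
  3⇒2 all = 1⇒2 (from ParksFrom⇔ParksAll (full⇒parks full) , from (all 1) (≤-trans (s≤s z≤n) n≥3))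
    where
    full : Full
    full v v≤n = to (∈burntList⇔B v) (from (all v) v≤n)
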